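{- Let $I$ be an inversive plane of even order $q$ and let $e$ be a set of two points of $I$. Then there are exactly $q-1$ circles $C$ of $I$ such that $C$ is tangent to every circle of $I$ containing $e$. Moreover, these $q-1$ circles partition the complement of $e$ in the point set of $I$.
   Context: An inversive plane of order $q$ is a $3$-$(q^2+1,q+1,1)$ design, i.e., a set of $q^2+1$ points with a family of $(q+1)$-subsets called circles such that any three distinct points lie in exactly one circle. Two circles are tangent if they have exactly one point in common. -}

module Defs where

open import Data.Nat using (ℕ; suc; _+_; _*_)
open import Data.Fin using (Fin)
open import Data.Fin.Subset using (Subset; _∈_; _∩_; ∣_∣)
open import Data.Product using (Σ; ∃; _×_)
open import Relation.Binary.PropositionalEquality using (_≡_; _≢_)

-- An inversive plane of order q: a 3-(q²+1, q+1, 1) design.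
record InversivePlane (q : ℕ) : Set where
  field
    numCircles : ℕ
    circle     : Fin numCircles → Subset (q * q + 1)
    circleSize : ∀ c → ∣ circle c ∣ ≡ suc q
    threeExist : ∀ (x y z : Fin (q * q + 1)) → x ≢ y → x ≢ z → y ≢ z →
                 ∃ λ c → (x ∈ circle c) × (y ∈ circle c) × (z ∈ circle c)
    threeUnique : ∀ (x y z : Fin (q * q + 1)) → x ≢ y → x ≢ z → y ≢ z →
                  ∀ c d → x ∈ circle c → y ∈ circle c → z ∈ circle c →
                  x ∈ circle d → y ∈ circle d → z ∈ circle d → c ≡ d

  Point : Set
  Point = Fin (q * q + 1)

  Circle : Set
  Circle = Fin numCircles

  Tangent : Circle → Circle → Set
  Tangent c d = ∣ circle c ∩ circle d ∣ ≡ 1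

  TangentToPencil : Point → Point → Circle → Set
  TangentToPencil x y c = ∀ d → x ∈ circle d → y ∈ circle d → Tangent c d

-- Fix a point v and a circle C ∌ v. Every point of C lies on exactly one circle through v
-- tangent to C, so v lies on q + 1 tangents of C. A point z ∉ C ∪ {v} lies on t tangents and
-- s secants through v with t + 2s = q + 1, so t is odd because q is even. Double counting
-- yields such a z on at least two tangents; along a secant through v the points off C would
-- need more tangents than there are, so no secant passes through z, and the q + 1 circles
-- through v and z are exactly the tangents through v: all of them pass through z, the
-- nucleus of (v, C). Hence a circle C ∌ x is tangent to every circle through x and y exactly
-- when y is the nucleus of (x, C). Such circles avoid x and y, and two of them sharing a
-- point p coincide: both pass through p and a common nucleus and touch the circle through
-- x, y, p at p. Counting the pairs (C, p) with p ∈ C over all y then shows that each of the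
-- q² − 1 points other than x and y lies on exactly one of them, so there are q − 1.

module Submission where

open import Defs
open import Data.Bool using (if_then_else_)
open import Data.Empty using (⊥-elim)
open import Data.Fin using (Fin; zero; suc) renaming (_≟_ to _≟ᶠ_)
open import Data.Fin.Properties using (all?) renaming (suc-injective to fsuc-injective)
open import Data.Fin.Subset using (Subset; _∈_; _∉_; _∩_; ∣_∣; inside; outside)
open import Data.Fin.Subset.Properties using (_∈?_)
open import Data.Nat using (ℕ; zero; suc; _+_; _*_; _∸_; _≤_; _<_; z≤n; s≤s)
open import Data.Nat.Divisibility using (_∣_; divides; ∣m+n∣m⇒∣n; ∣1⇒≡1)
open import Data.Nat.Properties
open import Algebra.Properties.Semiring.Sum +-*-semiring
  using (sum; ∑-comm; ∑-distrib-+; *-distribˡ-sum; *-distribʳ-sum; sum-cong-≗; sum-replicate-zero)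
open import Data.Nat.Tactic.RingSolver using (solve-∀)
open import Data.Product using (Σ; ∃; _×_; _,_; proj₁; proj₂)
open import Data.Sum using (inj₁; inj₂)
open import Data.Vec using ([]; _∷_)
open import Function.Bundles using (_⇔_; mk⇔; Equivalence)
open import Function.Definitions using (Injective)
open import Relation.Nullary using (Dec; yes; no; ¬_; does)
open import Relation.Nullary.Decidable using (_→-dec_; decidable-stable)
open import Relation.Binary.PropositionalEquality
  using (_≡_; _≢_; refl; sym; trans; cong; cong₂; subst; module ≡-Reasoning)

private variable
  n : ℕ

-- Defined through `does`, so that it also computes on decisions built with `map′`, such as `_∈?_`.
χ : ∀ {a} {A : Set a} → Dec A → ℕ
χ d = if does d then 1 else 0

module _ {a} {A : Set a} where

  χ≤1 : (d : Dec A) → χ d ≤ 1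
  χ≤1 (yes _) = s≤s z≤n
  χ≤1 (no _)  = z≤n

  χ-yes : (d : Dec A) → A → χ d ≡ 1
  χ-yes (yes _) _ = refl
  χ-yes (no ¬a) a = ⊥-elim (¬a a)

  χ-no : (d : Dec A) → ¬ A → χ d ≡ 0
  χ-no (yes a) ¬a = ⊥-elim (¬a a)
  χ-no (no _)  _  = refl

  χ-pos : (d : Dec A) → 0 < χ d → A
  χ-pos (yes a) _ = a

[_≢_] : Fin n → Fin n → ℕ
[ zero  ≢ zero  ] = 0
[ zero  ≢ suc _ ] = 1
[ suc _ ≢ zero  ] = 1
[ suc i ≢ suc j ] = [ i ≢ j ]

[≢]-refl : (i : Fin n) → [ i ≢ i ] ≡ 0
[≢]-refl zero    = refl
[≢]-refl (suc i) = [≢]-refl i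

[≢]-≢ : (i j : Fin n) → i ≢ j → [ i ≢ j ] ≡ 1
[≢]-≢ zero    zero    i≢j = ⊥-elim (i≢j refl)
[≢]-≢ zero    (suc j) _   = refl
[≢]-≢ (suc i) zero    _   = refl
[≢]-≢ (suc i) (suc j) i≢j = [≢]-≢ i j (λ e → i≢j (cong suc e))

[≢]≤1 : (i j : Fin n) → [ i ≢ j ] ≤ 1
[≢]≤1 zero    zero    = z≤n
[≢]≤1 zero    (suc j) = s≤s z≤n
[≢]≤1 (suc i) zero    = s≤s z≤n
[≢]≤1 (suc i) (suc j) = [≢]≤1 i j

[≢]-pos : (i j : Fin n) → 0 < [ i ≢ j ] → i ≢ j
[≢]-pos i .i p refl = <-irrefl (sym ([≢]-refl i)) p

sum-mono-≤ : {f g : Fin n → ℕ} → (∀ i → f i ≤ g i) → sum f ≤ sum g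
sum-mono-≤ {zero}  _   = z≤n
sum-mono-≤ {suc n} f≤g = +-mono-≤ (f≤g zero) (sum-mono-≤ (λ i → f≤g (suc i)))

sum-zero : {f : Fin n → ℕ} → (∀ i → f i ≡ 0) → sum f ≡ 0
sum-zero {n} f≗0 = trans (sum-cong-≗ f≗0) (sum-replicate-zero n)

sum-ones : sum {n} (λ _ → 1) ≡ n
sum-ones {zero}  = refl
sum-ones {suc n} = cong suc sum-ones

sum-extract : (a : Fin n) (f : Fin n → ℕ) → sum f ≡ f a + sum (λ i → [ i ≢ a ] * f i)
sum-extract zero    f = cong (f zero +_) (sum-cong-≗ (λ i → sym (+-identityʳ (f (suc i)))))
sum-extract (suc a) f = begin
  f zero + sum (λ i → f (suc i))
    ≡⟨ cong (f zero +_) (sum-extract a (λ i → f (suc i))) ⟩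
  f zero + (f (suc a) + rest)
    ≡⟨ swap-front (f zero) (f (suc a)) rest ⟩
  f (suc a) + (f zero + 0 + rest) ∎
  where
  open ≡-Reasoning
  rest = sum (λ i → [ i ≢ a ] * f (suc i))
  swap-front : ∀ x y r → x + (y + r) ≡ y + (x + 0 + r)
  swap-front = solve-∀

sum-extract₂ : (a b : Fin n) (f : Fin n → ℕ) → a ≢ b →
  sum f ≡ f a + f b + sum (λ i → [ i ≢ b ] * ([ i ≢ a ] * f i))
sum-extract₂ a b f a≢b = begin
  sum f                       ≡⟨ sum-extract a f ⟩
  f a + sum g                 ≡⟨ cong (f a +_) (sum-extract b g) ⟩
  f a + ([ b ≢ a ] * f b + r) ≡⟨ cong (λ t → f a + (t * f b + r)) ([≢]-≢ b a (λ e → a≢b (sym e))) ⟩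
  f a + (f b + 0 + r)         ≡⟨ cong (λ t → f a + (t + r)) (+-identityʳ (f b)) ⟩
  f a + (f b + r)             ≡⟨ sym (+-assoc (f a) (f b) r) ⟩
  f a + f b + r               ∎
  where
  open ≡-Reasoning
  g : Fin _ → ℕ
  g i = [ i ≢ a ] * f i
  r : ℕ
  r = sum (λ i → [ i ≢ b ] * g i)

term≤sum : (a : Fin n) (f : Fin n → ℕ) → f a ≤ sum f
term≤sum a f = ≤-trans (m≤m+n (f a) _) (≤-reflexive (sym (sum-extract a f)))

term+term≤sum : (a b : Fin n) (f : Fin n → ℕ) → a ≢ b → f a + f b ≤ sum f
term+term≤sum a b f a≢b = ≤-trans (m≤m+n (f a + f b) _) (≤-reflexive (sym (sum-extract₂ a b f a≢b)))

-- Abstract: the witnesses found here are only used through their properties, and unfolding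
-- them during conversion checking is prohibitively slow.
abstract
  sum-<⇒∃-< : (g f : Fin n → ℕ) → sum g < sum f → ∃ λ i → g i < f i
  sum-<⇒∃-< {suc n} g f g<f with g zero <? f zero
  ... | yes g₀<f₀ = zero , g₀<f₀
  ... | no  g₀≮f₀ =
    let (i , gi<fi) = sum-<⇒∃-< (λ i → g (suc i)) (λ i → f (suc i))
                        (+-cancelˡ-< (f zero) _ _ (≤-trans (s≤s (+-monoˡ-≤ _ (≮⇒≥ g₀≮f₀))) g<f))
    in suc i , gi<fi

sum-pos⇒∃-pos : (f : Fin n → ℕ) → 0 < sum f → ∃ λ i → 0 < f i
sum-pos⇒∃-pos {n} f 0<f = sum-<⇒∃-< (λ _ → 0) f (subst (_< sum f) (sym (sum-zero {n} (λ _ → refl))) 0<f)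

sum-mono-≤-tight : (f g : Fin n → ℕ) → (∀ i → f i ≤ g i) → sum f ≡ sum g → ∀ i → f i ≡ g i
sum-mono-≤-tight f g f≤g Σf≡Σg i = ≤-antisym (f≤g i) (+-cancelʳ-≤ _ _ _ (begin
  g i + sum (λ j → [ j ≢ i ] * f j) ≤⟨ +-monoʳ-≤ (g i) (sum-mono-≤ (λ j → *-monoʳ-≤ [ j ≢ i ] (f≤g j))) ⟩
  g i + sum (λ j → [ j ≢ i ] * g j) ≡⟨ sym (sum-extract i g) ⟩
  sum g                             ≡⟨ sym Σf≡Σg ⟩
  sum f                             ≡⟨ sum-extract i f ⟩
  f i + sum (λ j → [ j ≢ i ] * f j) ∎))
  where open ≤-Reasoning

*-pos⇒posˡ : ∀ x y → 0 < x * y → 0 < x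
*-pos⇒posˡ (suc x) y _ = s≤s z≤n

*-pos⇒posʳ : ∀ x y → 0 < x * y → 0 < y
*-pos⇒posʳ x y p = *-pos⇒posˡ y x (subst (0 <_) (*-comm x y) p)

guarded-≡ : ∀ {w x y} → w ≤ 1 → (w ≡ 1 → x ≡ y) → w * x ≡ w * y
guarded-≡ {w} w≤1 h with n≤1⇒n≡0∨n≡1 w≤1
... | inj₁ refl = refl
... | inj₂ refl = cong (_+ 0) (h refl)

guarded-≤ : ∀ {w x y} → w ≤ 1 → (w ≡ 1 → x ≤ y) → w * x ≤ w * y
guarded-≤ {w} w≤1 h with n≤1⇒n≡0∨n≡1 w≤1
... | inj₁ refl = z≤n
... | inj₂ refl = +-monoˡ-≤ 0 (h refl)

sum-mono-≤-gap : (f g : Fin n → ℕ) (a : Fin n) {d : ℕ} → (∀ i → f i ≤ g i) →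
  f a + d ≤ g a → sum f + d ≤ sum g
sum-mono-≤-gap f g a {d} f≤g gap = begin
  sum f + d        ≡⟨ cong (_+ d) (sum-extract a f) ⟩
  f a + rest f + d ≡⟨ gap-rearrange (f a) (rest f) d ⟩
  f a + d + rest f ≤⟨ +-mono-≤ gap (sum-mono-≤ (λ i → *-monoʳ-≤ [ i ≢ a ] (f≤g i))) ⟩
  g a + rest g     ≡⟨ sym (sum-extract a g) ⟩
  sum g            ∎
  where
  open ≤-Reasoning
  rest : (Fin _ → ℕ) → ℕ
  rest h = sum (λ i → [ i ≢ a ] * h i)
  gap-rearrange : ∀ x r d → x + r + d ≡ x + d + r
  gap-rearrange = solve-∀

sum-mono-≤-gap₂ : (f g : Fin n → ℕ) (a b : Fin n) → (∀ i → f i ≤ g i) → a ≢ b →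
  f a < g a → f b < g b → sum f + 2 ≤ sum g
sum-mono-≤-gap₂ f g a b f≤g a≢b gapa gapb = begin
  sum f + 2                  ≡⟨ cong (_+ 2) (sum-extract₂ a b f a≢b) ⟩
  f a + f b + rest f + 2     ≡⟨ two-gaps-rearrange (f a) (f b) (rest f) ⟩
  suc (f a) + suc (f b) + rest f
    ≤⟨ +-mono-≤ (+-mono-≤ gapa gapb) (sum-mono-≤ (λ i → *-monoʳ-≤ [ i ≢ b ] (*-monoʳ-≤ [ i ≢ a ] (f≤g i)))) ⟩
  g a + g b + rest g         ≡⟨ sym (sum-extract₂ a b g a≢b) ⟩
  sum g                      ∎
  where
  open ≤-Reasoning
  rest : (Fin _ → ℕ) → ℕ
  rest h = sum (λ i → [ i ≢ b ] * ([ i ≢ a ] * h i))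
  two-gaps-rearrange : ∀ x y r → x + y + r + 2 ≡ suc x + suc y + r
  two-gaps-rearrange = solve-∀

ZeroOne : (Fin n → ℕ) → Set
ZeroOne f = ∀ i → f i ≤ 1

two-in-support : (f : Fin n → ℕ) → ZeroOne f → 2 ≤ sum f →
  Σ (Fin n) λ a → Σ (Fin n) λ b → a ≢ b × 0 < f a × 0 < f b
two-in-support f f≤1 2≤Σf =
  let (a , fa>0) = sum-pos⇒∃-pos f (≤-trans (s≤s z≤n) 2≤Σf)
      rest>0 = +-cancelˡ-≤ 1 1 _ (≤-trans 2≤Σf (≤-trans (≤-reflexive (sum-extract a f)) (+-monoˡ-≤ _ (f≤1 a))))
      (b , gb>0) = sum-pos⇒∃-pos (λ i → [ i ≢ a ] * f i) rest>0
  in a , b , (λ a≡b → [≢]-pos b a (*-pos⇒posˡ [ b ≢ a ] (f b) gb>0) (sym a≡b)) ,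
     fa>0 , *-pos⇒posʳ [ b ≢ a ] (f b) gb>0

three-in-support : (f : Fin n → ℕ) → ZeroOne f → 3 ≤ sum f →
  Σ (Fin n) λ a → Σ (Fin n) λ b → Σ (Fin n) λ c →
    a ≢ b × a ≢ c × b ≢ c × 0 < f a × 0 < f b × 0 < f c
three-in-support f f≤1 3≤Σf =
  let (a , fa>0) = sum-pos⇒∃-pos f (≤-trans (s≤s z≤n) 3≤Σf)
      g = λ i → [ i ≢ a ] * f i
      2≤Σg = +-cancelˡ-≤ 1 2 _ (≤-trans 3≤Σf (≤-trans (≤-reflexive (sum-extract a f)) (+-monoˡ-≤ _ (f≤1 a))))
      g≤1 : ZeroOne g
      g≤1 i = *-mono-≤ ([≢]≤1 i a) (f≤1 i)
      (b , c , b≢c , gb>0 , gc>0) = two-in-support g g≤1 2≤Σg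
      a≢ : ∀ x → 0 < g x → a ≢ x
      a≢ x gx>0 a≡x = [≢]-pos x a (*-pos⇒posˡ [ x ≢ a ] (f x) gx>0) (sym a≡x)
  in a , b , c , a≢ b gb>0 , a≢ c gc>0 , b≢c ,
     fa>0 , *-pos⇒posʳ [ b ≢ a ] (f b) gb>0 , *-pos⇒posʳ [ c ≢ a ] (f c) gc>0

sum≤1 : (f : Fin n → ℕ) → ZeroOne f → (∀ i j → 0 < f i → 0 < f j → i ≡ j) → sum f ≤ 1
sum≤1 f f≤1 unique with sum f ≤? 1
... | yes Σf≤1 = Σf≤1
... | no  Σf≰1 =
  let (a , b , a≢b , fa>0 , fb>0) = two-in-support f f≤1 (≰⇒> Σf≰1)
  in ⊥-elim (a≢b (unique a b fa>0 fb>0))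

sum≡1⇒unique : (f : Fin n → ℕ) → sum f ≡ 1 → ∀ a b → 0 < f a → 0 < f b → a ≡ b
sum≡1⇒unique f Σf≡1 a b fa>0 fb>0 with a ≟ᶠ b
... | yes a≡b = a≡b
... | no  a≢b = ⊥-elim (<-irrefl refl (≤-trans (+-mono-≤ fa>0 fb>0)
                  (≤-trans (term+term≤sum a b f a≢b) (≤-reflexive Σf≡1))))

count : ∀ {n} {P : Fin n → Set} → (∀ i → Dec (P i)) → ℕ
count P? = sum (λ i → χ (P? i))

enumerate : ∀ {n} {P : Fin n → Set} (P? : ∀ i → Dec (P i)) → Fin (count P?) → Fin n
enumerate {suc n} P? j with P? zero
enumerate {suc n} P? zero    | yes _ = zero
enumerate {suc n} P? (suc j) | yes _ = suc (enumerate (λ i → P? (suc i)) j)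
enumerate {suc n} P? j       | no _  = suc (enumerate (λ i → P? (suc i)) j)

enumerate-sound : ∀ {n} {P : Fin n → Set} (P? : ∀ i → Dec (P i)) j → P (enumerate P? j)
enumerate-sound {suc n} P? j with P? zero
enumerate-sound {suc n} P? zero    | yes p = p
enumerate-sound {suc n} P? (suc j) | yes _ = enumerate-sound (λ i → P? (suc i)) j
enumerate-sound {suc n} P? j       | no _  = enumerate-sound (λ i → P? (suc i)) j

enumerate-injective : ∀ {n} {P : Fin n → Set} (P? : ∀ i → Dec (P i)) i j →
  enumerate P? i ≡ enumerate P? j → i ≡ j
enumerate-injective {suc n} P? i j e with P? zero
enumerate-injective {suc n} P? zero    zero    e  | yes _ = refl
enumerate-injective {suc n} P? (suc i) (suc j) e  | yes _ =
  cong suc (enumerate-injective (λ i → P? (suc i)) i j (fsuc-injective e))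
enumerate-injective {suc n} P? i       j       e  | no _  =
  enumerate-injective (λ i → P? (suc i)) i j (fsuc-injective e)

enumerate-complete : ∀ {n} {P : Fin n → Set} (P? : ∀ i → Dec (P i)) a → P a →
  ∃ λ j → enumerate P? j ≡ a
enumerate-complete {suc n} P? a pa with P? zero
enumerate-complete {suc n} P? zero    pa | yes _  = zero , refl
enumerate-complete {suc n} P? (suc a) pa | yes _  =
  let (j , e) = enumerate-complete (λ i → P? (suc i)) a pa in suc j , cong suc e
enumerate-complete {suc n} P? zero    pa | no ¬p0 = ⊥-elim (¬p0 pa)
enumerate-complete {suc n} P? (suc a) pa | no _   =
  let (j , e) = enumerate-complete (λ i → P? (suc i)) a pa in j , cong suc e

enumeration : ∀ {m n} {P : Fin m → Set} (P? : ∀ i → Dec (P i)) → count P? ≡ n →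
  Σ (Fin n → Fin m) λ f → Injective _≡_ _≡_ f × (∀ a → P a ⇔ ∃ λ i → f i ≡ a)
enumeration {P = P} P? refl =
  enumerate P? ,
  (λ {i} {j} → enumerate-injective P? i j) ,
  (λ a → mk⇔ (enumerate-complete P? a) (λ (i , fi≡a) → subst P fi≡a (enumerate-sound P? i)))

∣∣≡sum : ∀ {m} (s : Subset m) → ∣ s ∣ ≡ sum (λ i → χ (i ∈? s))
∣∣≡sum []            = refl
∣∣≡sum (inside  ∷ s) = cong suc (∣∣≡sum s)
∣∣≡sum (outside ∷ s) = ∣∣≡sum s

∣∩∣≡sum : ∀ {m} (s t : Subset m) → ∣ s ∩ t ∣ ≡ sum (λ i → χ (i ∈? s) * χ (i ∈? t))
∣∩∣≡sum []            []            = refl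
∣∩∣≡sum (inside  ∷ s) (inside  ∷ t) = cong suc (∣∩∣≡sum s t)
∣∩∣≡sum (inside  ∷ s) (outside ∷ t) = ∣∩∣≡sum s t
∣∩∣≡sum (outside ∷ s) (inside  ∷ t) = ∣∩∣≡sum s t
∣∩∣≡sum (outside ∷ s) (outside ∷ t) = ∣∩∣≡sum s t

module Incidence {k : ℕ} (I : InversivePlane (suc (suc k))) where

  open InversivePlane I public

  q : ℕ
  q = suc (suc k)

  [_∈_] : Point → Circle → ℕ
  [ p ∈ c ] = χ (p ∈? circle c)

  [∈]≤1 : ∀ p c → [ p ∈ c ] ≤ 1
  [∈]≤1 p c = χ≤1 (p ∈? circle c)

  ∈⇒[∈]≡1 : ∀ {p c} → p ∈ circle c → [ p ∈ c ] ≡ 1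
  ∈⇒[∈]≡1 {p} {c} = χ-yes (p ∈? circle c)

  ∉⇒[∈]≡0 : ∀ {p c} → p ∉ circle c → [ p ∈ c ] ≡ 0
  ∉⇒[∈]≡0 {p} {c} = χ-no (p ∈? circle c)

  [∈]-pos⇒∈ : ∀ {p c} → 0 < [ p ∈ c ] → p ∈ circle c
  [∈]-pos⇒∈ {p} {c} = χ-pos (p ∈? circle c)

  [∈]≡1⇒∈ : ∀ {p c} → [ p ∈ c ] ≡ 1 → p ∈ circle c
  [∈]≡1⇒∈ e = [∈]-pos⇒∈ (≤-reflexive (sym e))

  circle-size : ∀ c → sum (λ p → [ p ∈ c ]) ≡ suc q
  circle-size c = trans (sym (∣∣≡sum (circle c))) (circleSize c)

  meet : Circle → Circle → ℕ
  meet c d = sum (λ p → [ p ∈ c ] * [ p ∈ d ])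

  meet-sym : ∀ c d → meet c d ≡ meet d c
  meet-sym c d = sum-cong-≗ (λ p → *-comm [ p ∈ c ] [ p ∈ d ])

  [∈]*[∈]-common≤1 : ∀ p c d → [ p ∈ c ] * [ p ∈ d ] ≤ 1
  [∈]*[∈]-common≤1 p c d = *-mono-≤ ([∈]≤1 p c) ([∈]≤1 p d)

  common-pos⇒∈ : ∀ {p c d} → 0 < [ p ∈ c ] * [ p ∈ d ] → p ∈ circle c × p ∈ circle d
  common-pos⇒∈ {p} {c} h = [∈]-pos⇒∈ (*-pos⇒posˡ [ p ∈ c ] _ h) , [∈]-pos⇒∈ (*-pos⇒posʳ [ p ∈ c ] _ h)

  ∈⇒common-pos : ∀ {p c d} → p ∈ circle c → p ∈ circle d → 0 < [ p ∈ c ] * [ p ∈ d ]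
  ∈⇒common-pos p∈c p∈d rewrite ∈⇒[∈]≡1 p∈c | ∈⇒[∈]≡1 p∈d = s≤s z≤n

  Tangent⇒meet≡1 : ∀ {c d} → Tangent c d → meet c d ≡ 1
  Tangent⇒meet≡1 {c} {d} t = trans (sym (∣∩∣≡sum (circle c) (circle d))) t

  meet≡1⇒Tangent : ∀ {c d} → meet c d ≡ 1 → Tangent c d
  meet≡1⇒Tangent {c} {d} m = trans (∣∩∣≡sum (circle c) (circle d)) m

  [∈]*[∈]≤1 : ∀ a b L → [ a ∈ L ] * [ b ∈ L ] ≤ 1
  [∈]*[∈]≤1 a b L = *-mono-≤ ([∈]≤1 a L) ([∈]≤1 b L)

  [∈]*[∈]-pos⇒∈ : ∀ {a b L} → 0 < [ a ∈ L ] * [ b ∈ L ] → a ∈ circle L × b ∈ circle L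
  [∈]*[∈]-pos⇒∈ {a} {b} {L} h = [∈]-pos⇒∈ (*-pos⇒posˡ [ a ∈ L ] _ h) , [∈]-pos⇒∈ (*-pos⇒posʳ [ a ∈ L ] _ h)

  [∈]*[∈]≡1⇒∈ : ∀ {a b L} → [ a ∈ L ] * [ b ∈ L ] ≡ 1 → a ∈ circle L × b ∈ circle L
  [∈]*[∈]≡1⇒∈ e = [∈]*[∈]-pos⇒∈ (≤-reflexive (sym e))

  circles-through-three≡1 : ∀ {a b z} → a ≢ b → a ≢ z → b ≢ z →
    sum (λ c → [ a ∈ c ] * [ b ∈ c ] * [ z ∈ c ]) ≡ 1
  circles-through-three≡1 {a} {b} {z} a≢b a≢z b≢z =
    let (c₀ , a∈c₀ , b∈c₀ , z∈c₀) = threeExist a b z a≢b a≢z b≢z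
        fc₀≡1 = cong₂ _*_ (cong₂ _*_ (∈⇒[∈]≡1 a∈c₀) (∈⇒[∈]≡1 b∈c₀)) (∈⇒[∈]≡1 z∈c₀)
    in ≤-antisym (sum≤1 f (λ c → *-mono-≤ ([∈]*[∈]≤1 a b c) ([∈]≤1 z c)) unique)
                 (≤-trans (≤-reflexive (sym fc₀≡1)) (term≤sum c₀ f))
    where
    f : Circle → ℕ
    f c = [ a ∈ c ] * [ b ∈ c ] * [ z ∈ c ]
    through : ∀ c → 0 < f c → a ∈ circle c × b ∈ circle c × z ∈ circle c
    through c fc>0 = let (a∈c , b∈c) = [∈]*[∈]-pos⇒∈ (*-pos⇒posˡ ([ a ∈ c ] * [ b ∈ c ]) _ fc>0)
                     in a∈c , b∈c , [∈]-pos⇒∈ (*-pos⇒posʳ ([ a ∈ c ] * [ b ∈ c ]) _ fc>0)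
    unique : ∀ c d → 0 < f c → 0 < f d → c ≡ d
    unique c d fc>0 fd>0 = let (a∈c , b∈c , z∈c) = through c fc>0 ; (a∈d , b∈d , z∈d) = through d fd>0
      in threeUnique a b z a≢b a≢z b≢z c d a∈c b∈c z∈c a∈d b∈d z∈d

  meet≤2 : ∀ {c d} → c ≢ d → meet c d ≤ 2
  meet≤2 {c} {d} c≢d with meet c d ≤? 2
  ... | yes m≤2 = m≤2
  ... | no  m≰2 =
    let (a , b , z , a≢b , a≢z , b≢z , a>0 , b>0 , z>0) =
          three-in-support (λ p → [ p ∈ c ] * [ p ∈ d ]) (λ p → [∈]*[∈]-common≤1 p c d) (≰⇒> m≰2)
        (a∈c , a∈d) = common-pos⇒∈ a>0
        (b∈c , b∈d) = common-pos⇒∈ b>0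
        (z∈c , z∈d) = common-pos⇒∈ z>0
    in ⊥-elim (c≢d (threeUnique a b z a≢b a≢z b≢z c d a∈c b∈c z∈c a∈d b∈d z∈d))

  on-circle-≡ : ∀ p L {x y} → (p ∈ circle L → x ≡ y) → [ p ∈ L ] * x ≡ [ p ∈ L ] * y
  on-circle-≡ p L h = guarded-≡ ([∈]≤1 p L) (λ e → h ([∈]≡1⇒∈ e))

  on-pencil-≡ : ∀ a b L {x y} → (a ∈ circle L → b ∈ circle L → x ≡ y) →
    [ a ∈ L ] * [ b ∈ L ] * x ≡ [ a ∈ L ] * [ b ∈ L ] * y
  on-pencil-≡ a b L h = guarded-≡ ([∈]*[∈]≤1 a b L) (λ e → let (a∈ , b∈) = [∈]*[∈]≡1⇒∈ e in h a∈ b∈)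

  on-pencil-≤ : ∀ a b L {x y} → (a ∈ circle L → b ∈ circle L → x ≤ y) →
    [ a ∈ L ] * [ b ∈ L ] * x ≤ [ a ∈ L ] * [ b ∈ L ] * y
  on-pencil-≤ a b L h = guarded-≤ ([∈]*[∈]≤1 a b L) (λ e → let (a∈ , b∈) = [∈]*[∈]≡1⇒∈ e in h a∈ b∈)

  pencil-partition : ∀ {v z} → v ≢ z → (g : Point → ℕ) → g v ≡ 0 → g z ≡ 0 →
    sum (λ L → [ v ∈ L ] * [ z ∈ L ] * sum (λ p → [ p ∈ L ] * g p)) ≡ sum g
  pencil-partition {v} {z} v≢z g gv≡0 gz≡0 = begin
    sum (λ L → [ v ∈ L ] * [ z ∈ L ] * sum (λ p → [ p ∈ L ] * g p))
      ≡⟨ sum-cong-≗ (λ L → *-distribˡ-sum ([ v ∈ L ] * [ z ∈ L ]) (λ p → [ p ∈ L ] * g p)) ⟩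
    sum (λ L → sum (λ p → [ v ∈ L ] * [ z ∈ L ] * ([ p ∈ L ] * g p)))
      ≡⟨ ∑-comm (λ L p → [ v ∈ L ] * [ z ∈ L ] * ([ p ∈ L ] * g p)) ⟩
    sum (λ p → sum (λ L → [ v ∈ L ] * [ z ∈ L ] * ([ p ∈ L ] * g p)))
      ≡⟨ sum-cong-≗ (λ p → trans (sum-cong-≗ (λ L → sym (*-assoc ([ v ∈ L ] * [ z ∈ L ]) [ p ∈ L ] (g p))))
                                 (sym (*-distribʳ-sum (g p) (λ L → [ v ∈ L ] * [ z ∈ L ] * [ p ∈ L ])))) ⟩
    sum (λ p → sum (λ L → [ v ∈ L ] * [ z ∈ L ] * [ p ∈ L ]) * g p)
      ≡⟨ sum-cong-≗ weight ⟩
    sum g ∎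
    where
    open ≡-Reasoning
    circles-through : Point → ℕ
    circles-through p = sum (λ L → [ v ∈ L ] * [ z ∈ L ] * [ p ∈ L ])
    weight : ∀ p → circles-through p * g p ≡ g p
    weight p with p ≟ᶠ v | p ≟ᶠ z
    ... | yes refl | _        = trans (cong (circles-through p *_) gv≡0) (trans (*-zeroʳ (circles-through p)) (sym gv≡0))
    ... | no  _    | yes refl = trans (cong (circles-through p *_) gz≡0) (trans (*-zeroʳ (circles-through p)) (sym gz≡0))
    ... | no  p≢v  | no  p≢z  =
      trans (cong (_* g p) (circles-through-three≡1 v≢z (λ e → p≢v (sym e)) (λ e → p≢z (sym e)))) (*-identityˡ (g p))

  circle-size-without : ∀ {a L} → a ∈ circle L → sum (λ p → [ p ≢ a ] * [ p ∈ L ]) ≡ q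
  circle-size-without {a} {L} a∈L = +-cancelˡ-≡ 1 _ _ (begin
    1 + rest              ≡⟨ cong (_+ rest) (sym (∈⇒[∈]≡1 a∈L)) ⟩
    [ a ∈ L ] + rest      ≡⟨ sym (sum-extract a (λ p → [ p ∈ L ])) ⟩
    sum (λ p → [ p ∈ L ]) ≡⟨ circle-size L ⟩
    1 + q                 ∎)
    where
    open ≡-Reasoning
    rest : ℕ
    rest = sum (λ p → [ p ≢ a ] * [ p ∈ L ])

  circle-size-without₂ : ∀ {a b L} → a ≢ b → a ∈ circle L → b ∈ circle L →
    sum (λ p → [ p ≢ b ] * ([ p ≢ a ] * [ p ∈ L ])) ≡ suc k
  circle-size-without₂ {a} {b} {L} a≢b a∈L b∈L = +-cancelˡ-≡ 2 _ _ (begin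
    2 + rest                     ≡⟨ cong (_+ rest) (sym (cong₂ _+_ (∈⇒[∈]≡1 a∈L) (∈⇒[∈]≡1 b∈L))) ⟩
    [ a ∈ L ] + [ b ∈ L ] + rest ≡⟨ sym (sum-extract₂ a b (λ p → [ p ∈ L ]) a≢b) ⟩
    sum (λ p → [ p ∈ L ])        ≡⟨ circle-size L ⟩
    2 + suc k                    ∎)
    where
    open ≡-Reasoning
    rest : ℕ
    rest = sum (λ p → [ p ≢ b ] * ([ p ≢ a ] * [ p ∈ L ]))

  point-count : sum (λ (_ : Point) → 1) ≡ q * q + 1
  point-count = sum-ones

  pencil-size : ∀ {a b} → a ≢ b → sum (λ L → [ a ∈ L ] * [ b ∈ L ]) ≡ suc q
  pencil-size {a} {b} a≢b = *-cancelʳ-≡ _ _ (suc k) (+-cancelʳ-≡ 2 _ _ (begin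
    sum (λ L → [ a ∈ L ] * [ b ∈ L ]) * suc k + 2
      ≡⟨ cong (_+ 2) (*-distribʳ-sum (suc k) (λ L → [ a ∈ L ] * [ b ∈ L ])) ⟩
    sum (λ L → [ a ∈ L ] * [ b ∈ L ] * suc k) + 2
      ≡⟨ cong (_+ 2) (sum-cong-≗ (λ L → on-pencil-≡ a b L (λ a∈L b∈L → sym (rest-of-circle L a∈L b∈L)))) ⟩
    sum (λ L → [ a ∈ L ] * [ b ∈ L ] * sum (λ p → [ p ∈ L ] * g p)) + 2
      ≡⟨ cong (_+ 2) (pencil-partition a≢b g ga≡0 gb≡0) ⟩
    sum g + 2
      ≡⟨ +-comm (sum g) 2 ⟩
    2 + sum g
      ≡⟨ sym (sum-extract₂ a b (λ _ → 1) a≢b) ⟩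
    sum (λ (_ : Point) → 1)
      ≡⟨ point-count ⟩
    q * q + 1
      ≡⟨ square+1 k ⟩
    suc q * suc k + 2 ∎))
    where
    open ≡-Reasoning
    g : Point → ℕ
    g p = [ p ≢ b ] * ([ p ≢ a ] * 1)
    ga≡0 : g a ≡ 0
    ga≡0 = trans (cong (λ t → [ a ≢ b ] * (t * 1)) ([≢]-refl a)) (*-zeroʳ [ a ≢ b ])
    gb≡0 : g b ≡ 0
    gb≡0 = cong (_* ([ b ≢ a ] * 1)) ([≢]-refl b)
    square+1 : ∀ k → (2 + k) * (2 + k) + 1 ≡ (3 + k) * (1 + k) + 2
    square+1 = solve-∀
    reorder : ∀ m x y → m * (x * (y * 1)) ≡ x * (y * m)
    reorder = solve-∀
    rest-of-circle : ∀ L → a ∈ circle L → b ∈ circle L → sum (λ p → [ p ∈ L ] * g p) ≡ suc k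
    rest-of-circle L a∈L b∈L = trans (sum-cong-≗ (λ p → reorder [ p ∈ L ] [ p ≢ b ] [ p ≢ a ]))
                                     (circle-size-without₂ a≢b a∈L b∈L)

  point-count-without : ∀ p → sum (λ (z : Point) → [ z ≢ p ] * 1) ≡ q * q
  point-count-without p = +-cancelˡ-≡ 1 _ _ (begin
    1 + sum (λ (z : Point) → [ z ≢ p ] * 1) ≡⟨ sum-extract p (λ _ → 1) ⟨
    sum (λ (_ : Point) → 1)                 ≡⟨ point-count ⟩
    q * q + 1                               ≡⟨ +-comm (q * q) 1 ⟩
    1 + q * q                               ∎)
    where open ≡-Reasoning

  star-size : ∀ p → sum (λ L → [ p ∈ L ]) ≡ q * suc q
  star-size p = *-cancelʳ-≡ _ _ q (begin
    sum (λ L → [ p ∈ L ]) * q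
      ≡⟨ *-distribʳ-sum q (λ L → [ p ∈ L ]) ⟩
    sum (λ L → [ p ∈ L ] * q)
      ≡⟨ sum-cong-≗ (λ L → on-circle-≡ p L (λ p∈L → sym (circle-size-without p∈L))) ⟩
    sum (λ L → [ p ∈ L ] * sum (λ z → [ z ≢ p ] * [ z ∈ L ]))
      ≡⟨ sum-cong-≗ (λ L → *-distribˡ-sum [ p ∈ L ] (λ z → [ z ≢ p ] * [ z ∈ L ])) ⟩
    sum (λ L → sum (λ z → [ p ∈ L ] * ([ z ≢ p ] * [ z ∈ L ])))
      ≡⟨ ∑-comm (λ L z → [ p ∈ L ] * ([ z ≢ p ] * [ z ∈ L ])) ⟩
    sum (λ z → sum (λ L → [ p ∈ L ] * ([ z ≢ p ] * [ z ∈ L ])))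
      ≡⟨ sum-cong-≗ (λ z → trans (sum-cong-≗ (λ L → swap-middle [ p ∈ L ] [ z ≢ p ] [ z ∈ L ]))
                                 (sym (*-distribˡ-sum [ z ≢ p ] (λ L → [ p ∈ L ] * [ z ∈ L ])))) ⟩
    sum (λ z → [ z ≢ p ] * sum (λ L → [ p ∈ L ] * [ z ∈ L ]))
      ≡⟨ sum-cong-≗ through-p-and ⟩
    sum (λ z → [ z ≢ p ] * 1 * suc q)
      ≡⟨ sym (*-distribʳ-sum (suc q) (λ (z : Point) → [ z ≢ p ] * 1)) ⟩
    sum (λ (z : Point) → [ z ≢ p ] * 1) * suc q
      ≡⟨ cong (_* suc q) (point-count-without p) ⟩
    q * q * suc q
      ≡⟨ rotate q ⟩
    q * suc q * q ∎)
    where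
    open ≡-Reasoning
    swap-middle : ∀ a b c → a * (b * c) ≡ b * (a * c)
    swap-middle = solve-∀
    rotate : ∀ q → q * q * suc q ≡ q * suc q * q
    rotate = solve-∀
    through-p-and : ∀ z → [ z ≢ p ] * sum (λ L → [ p ∈ L ] * [ z ∈ L ]) ≡ [ z ≢ p ] * 1 * suc q
    through-p-and z with z ≟ᶠ p
    ... | yes refl rewrite [≢]-refl z = refl
    ... | no  z≢p  rewrite [≢]-≢ z p z≢p = cong (_+ 0) (pencil-size (λ e → z≢p (sym e)))

  [_∉_] : Point → Circle → ℕ
  [ p ∉ c ] = 1 ∸ [ p ∈ c ]

  [∉]+[∈]≡1 : ∀ p c → [ p ∉ c ] + [ p ∈ c ] ≡ 1
  [∉]+[∈]≡1 p c = m∸n+n≡m ([∈]≤1 p c)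

  circles-through-avoiding : ∀ p x → sum (λ L → [ x ∉ L ] * [ p ∈ L ]) ≡ [ p ≢ x ] * (suc k * suc q)
  circles-through-avoiding p x with p ≟ᶠ x
  ... | yes refl rewrite [≢]-refl p = sum-zero (λ L → never-both L)
    where
    never-both : ∀ L → [ p ∉ L ] * [ p ∈ L ] ≡ 0
    never-both L with n≤1⇒n≡0∨n≡1 ([∈]≤1 p L)
    ... | inj₁ e rewrite e = refl
    ... | inj₂ e rewrite e = refl
  ... | no  p≢x rewrite [≢]-≢ p x p≢x = +-cancelʳ-≡ (suc q) _ _ (begin
    avoiding + suc q
      ≡⟨ cong (avoiding +_) (sym (trans (sum-cong-≗ (λ L → *-comm [ x ∈ L ] [ p ∈ L ])) (pencil-size p≢x))) ⟩
    avoiding + sum (λ L → [ x ∈ L ] * [ p ∈ L ])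
      ≡⟨ sym (∑-distrib-+ (λ L → [ x ∉ L ] * [ p ∈ L ]) (λ L → [ x ∈ L ] * [ p ∈ L ])) ⟩
    sum (λ L → [ x ∉ L ] * [ p ∈ L ] + [ x ∈ L ] * [ p ∈ L ])
      ≡⟨ sum-cong-≗ (λ L → trans (sym (*-distribʳ-+ [ p ∈ L ] [ x ∉ L ] [ x ∈ L ]))
                                 (trans (cong (_* [ p ∈ L ]) ([∉]+[∈]≡1 x L)) (*-identityˡ [ p ∈ L ]))) ⟩
    sum (λ L → [ p ∈ L ])
      ≡⟨ star-size p ⟩
    q * suc q
      ≡⟨ split-q k ⟩
    (suc k * suc q + 0) + suc q ∎)
    where
    open ≡-Reasoning
    avoiding : ℕ
    avoiding = sum (λ L → [ x ∉ L ] * [ p ∈ L ])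
    split-q : ∀ k → (2 + k) * (3 + k) ≡ ((1 + k) * (3 + k) + 0) + (3 + k)
    split-q = solve-∀

  meet-without-≤1 : ∀ {a L ℓ} → L ≢ ℓ → a ∈ circle L → a ∈ circle ℓ →
    sum (λ u → [ u ≢ a ] * ([ u ∈ L ] * [ u ∈ ℓ ])) ≤ 1
  meet-without-≤1 {a} {L} {ℓ} L≢ℓ a∈L a∈ℓ = +-cancelˡ-≤ 1 _ 1 (begin
    1 + rest                     ≡⟨ cong (_+ rest) (sym (cong₂ _*_ (∈⇒[∈]≡1 a∈L) (∈⇒[∈]≡1 a∈ℓ))) ⟩
    [ a ∈ L ] * [ a ∈ ℓ ] + rest ≡⟨ sym (sum-extract a (λ u → [ u ∈ L ] * [ u ∈ ℓ ])) ⟩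
    meet L ℓ                     ≤⟨ meet≤2 L≢ℓ ⟩
    2                            ∎)
    where
    open ≤-Reasoning
    rest : ℕ
    rest = sum (λ u → [ u ≢ a ] * ([ u ∈ L ] * [ u ∈ ℓ ]))

  meet-without₂≡0 : ∀ {a b L ℓ} → L ≢ ℓ → a ≢ b → a ∈ circle L → a ∈ circle ℓ → b ∈ circle L → b ∈ circle ℓ →
    sum (λ u → [ u ≢ b ] * ([ u ≢ a ] * ([ u ∈ L ] * [ u ∈ ℓ ]))) ≡ 0
  meet-without₂≡0 {a} {b} {L} {ℓ} L≢ℓ a≢b a∈L a∈ℓ b∈L b∈ℓ = n≤0⇒n≡0 (+-cancelˡ-≤ 2 _ 0 (begin
    2 + rest ≡⟨ cong (_+ rest) (sym (cong₂ _+_ (cong₂ _*_ (∈⇒[∈]≡1 a∈L) (∈⇒[∈]≡1 a∈ℓ))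
                                                (cong₂ _*_ (∈⇒[∈]≡1 b∈L) (∈⇒[∈]≡1 b∈ℓ)))) ⟩
    [ a ∈ L ] * [ a ∈ ℓ ] + [ b ∈ L ] * [ b ∈ ℓ ] + rest
             ≡⟨ sym (sum-extract₂ a b (λ u → [ u ∈ L ] * [ u ∈ ℓ ]) a≢b) ⟩
    meet L ℓ ≤⟨ meet≤2 L≢ℓ ⟩
    2        ∎))
    where
    open ≤-Reasoning
    rest : ℕ
    rest = sum (λ u → [ u ≢ b ] * ([ u ≢ a ] * ([ u ∈ L ] * [ u ∈ ℓ ])))

  meet≡1⇒common-unique : ∀ {a b L ℓ} → meet L ℓ ≡ 1 →
    a ∈ circle L → a ∈ circle ℓ → b ∈ circle L → b ∈ circle ℓ → a ≡ b
  meet≡1⇒common-unique {a} {b} {L} {ℓ} m≡1 a∈L a∈ℓ b∈L b∈ℓ =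
    sum≡1⇒unique (λ u → [ u ∈ L ] * [ u ∈ ℓ ]) m≡1 a b (∈⇒common-pos a∈L a∈ℓ) (∈⇒common-pos b∈L b∈ℓ)

  [∉]-pos⇒∉ : ∀ {p c} → 0 < [ p ∉ c ] → p ∉ circle c
  [∉]-pos⇒∉ {p} {c} pos p∈c with () ← subst (λ m → 0 < 1 ∸ m) (∈⇒[∈]≡1 p∈c) pos

  ∃-off-circle : ∀ D → Σ Point λ z → z ∉ circle D
  ∃-off-circle D = let (z , pos) = sum-pos⇒∃-pos (λ u → [ u ∉ D ]) Σ∉-pos in z , [∉]-pos⇒∉ pos
    where
    square+1 : ∀ k → (2 + k) * (2 + k) + 1 ≡ suc (k * k + 3 * k + 1) + (3 + k)
    square+1 = solve-∀
    Σ∉+1+q : sum (λ u → [ u ∉ D ]) + suc q ≡ q * q + 1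
    Σ∉+1+q = trans (cong (sum (λ u → [ u ∉ D ]) +_) (sym (circle-size D)))
               (trans (sym (∑-distrib-+ (λ u → [ u ∉ D ]) (λ u → [ u ∈ D ])))
                 (trans (sum-cong-≗ (λ u → [∉]+[∈]≡1 u D)) point-count))
    Σ∉-pos : 0 < sum (λ u → [ u ∉ D ])
    Σ∉-pos = subst (0 <_) (sym (+-cancelʳ-≡ (suc q) _ _ (trans Σ∉+1+q (square+1 k)))) (s≤s z≤n)

  ∃-on-circle-avoiding₂ : ∀ D {a b} → a ≢ b → Σ Point λ c → c ∈ circle D × c ≢ a × c ≢ b
  ∃-on-circle-avoiding₂ D {a} {b} a≢b =
    let (c , pos) = sum-pos⇒∃-pos (λ p → [ p ≢ b ] * ([ p ≢ a ] * [ p ∈ D ])) rest-pos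
        inner-pos = *-pos⇒posʳ [ c ≢ b ] _ pos
    in c , [∈]-pos⇒∈ (*-pos⇒posʳ [ c ≢ a ] _ inner-pos) ,
       [≢]-pos c a (*-pos⇒posˡ [ c ≢ a ] _ inner-pos) , [≢]-pos c b (*-pos⇒posˡ [ c ≢ b ] _ pos)
    where
    rest : ℕ
    rest = sum (λ p → [ p ≢ b ] * ([ p ≢ a ] * [ p ∈ D ]))
    rest-pos : 0 < rest
    rest-pos = +-cancelˡ-≤ 2 1 rest (begin
      3                             ≤⟨ s≤s (s≤s (s≤s z≤n)) ⟩
      suc q                         ≡⟨ sym (circle-size D) ⟩
      sum (λ p → [ p ∈ D ])         ≡⟨ sum-extract₂ a b (λ p → [ p ∈ D ]) a≢b ⟩
      [ a ∈ D ] + [ b ∈ D ] + rest  ≤⟨ +-monoˡ-≤ rest (+-mono-≤ ([∈]≤1 a D) ([∈]≤1 b D)) ⟩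
      2 + rest                      ∎)
      where open ≤-Reasoning

t+2s≡odd⇒t≢0∧t≢2 : ∀ {q t s} → 2 ∣ q → t + 2 * s ≡ suc q → t ≢ 0 × t ≢ 2
t+2s≡odd⇒t≢0∧t≢2 {q} {t} {s} 2∣q t+2s≡1+q =
  (λ { refl → 2∤1+q (divides s (trans (sym t+2s≡1+q) (*-comm 2 s))) }) ,
  (λ { refl → 2∤1+q (divides (suc s) (trans (sym t+2s≡1+q) (two-more s))) })
  where
  2∤1+q : ¬ 2 ∣ suc q
  2∤1+q 2∣1+q with () ← ∣1⇒≡1 (∣m+n∣m⇒∣n (subst (2 ∣_) (+-comm 1 q) 2∣1+q) 2∣q)
  two-more : ∀ s → 2 + 2 * s ≡ suc s * 2
  two-more = solve-∀

module TangentsThrough {k : ℕ} (I : InversivePlane (suc (suc k)))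
                       (v : InversivePlane.Point I) (C : InversivePlane.Circle I)
                       (v∉C : v ∉ InversivePlane.circle I C) where

  open Incidence I

  tangent : Circle → ℕ
  tangent L = χ (meet L C ≟ 1)

  tangents-through : Point → ℕ
  tangents-through z = sum (λ L → [ v ∈ L ] * [ z ∈ L ] * tangent L)

  v∈L⇒L≢C : ∀ {L} → v ∈ circle L → L ≢ C
  v∈L⇒L≢C v∈L refl = v∉C v∈L

  ∈C⇒≢v : ∀ {c} → c ∈ circle C → c ≢ v
  ∈C⇒≢v c∈C refl = v∉C c∈C

  meet≤2-through-v : ∀ {L} → v ∈ circle L → meet L C ≤ 2
  meet≤2-through-v v∈L = meet≤2 (v∈L⇒L≢C v∈L)

  module _ {c : Point} (c∈C : c ∈ circle C) where

    others-on-C : Point → ℕ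
    others-on-C p = [ p ∈ C ] * [ p ≢ c ]

    second-meets : Circle → ℕ
    second-meets L = sum (λ p → [ p ∈ L ] * others-on-C p)

    meet-through-c : ∀ {L} → c ∈ circle L → meet L C ≡ suc (second-meets L)
    meet-through-c {L} c∈L = trans (sum-extract c (λ p → [ p ∈ L ] * [ p ∈ C ]))
      (cong₂ _+_ (cong₂ _*_ (∈⇒[∈]≡1 c∈L) (∈⇒[∈]≡1 c∈C)) (sum-cong-≗ (λ p → rotate [ p ≢ c ] [ p ∈ L ] [ p ∈ C ])))
      where
      rotate : ∀ a b d → a * (b * d) ≡ b * (d * a)
      rotate = solve-∀

    tangent+second≡1 : ∀ {L} → v ∈ circle L → c ∈ circle L → tangent L + second-meets L ≡ 1
    tangent+second≡1 {L} v∈L c∈L = lemma (second-meets L) (meet-through-c c∈L)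
      where
      lemma : ∀ x → meet L C ≡ suc x → tangent L + x ≡ 1
      lemma zero          m≡1 rewrite m≡1 = refl
      lemma (suc zero)    m≡2 rewrite m≡2 = refl
      lemma (suc (suc x)) m≡3 with s≤s (s≤s ()) ← ≤-trans (≤-reflexive (sym m≡3)) (meet≤2-through-v v∈L)

    tangents-at≡1 : tangents-through c ≡ 1
    tangents-at≡1 = +-cancelʳ-≡ q _ _ (begin
      tangents-through c + q
        ≡⟨ cong (tangents-through c +_) (sym (trans (pencil-partition v≢c others-on-C g[v]≡0 g[c]≡0) Σothers≡q)) ⟩
      tangents-through c + sum (λ L → [ v ∈ L ] * [ c ∈ L ] * second-meets L)
        ≡⟨ sym (∑-distrib-+ (λ L → [ v ∈ L ] * [ c ∈ L ] * tangent L) (λ L → [ v ∈ L ] * [ c ∈ L ] * second-meets L)) ⟩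
      sum (λ L → [ v ∈ L ] * [ c ∈ L ] * tangent L + [ v ∈ L ] * [ c ∈ L ] * second-meets L)
        ≡⟨ sum-cong-≗ per-circle ⟩
      sum (λ L → [ v ∈ L ] * [ c ∈ L ] * 1)
        ≡⟨ sum-cong-≗ (λ L → *-identityʳ ([ v ∈ L ] * [ c ∈ L ])) ⟩
      sum (λ L → [ v ∈ L ] * [ c ∈ L ])
        ≡⟨ pencil-size v≢c ⟩
      1 + q ∎)
      where
      open ≡-Reasoning
      v≢c : v ≢ c
      v≢c e = ∈C⇒≢v c∈C (sym e)
      g[v]≡0 : others-on-C v ≡ 0
      g[v]≡0 = cong (_* [ v ≢ c ]) (∉⇒[∈]≡0 v∉C)
      g[c]≡0 : others-on-C c ≡ 0
      g[c]≡0 = trans (cong ([ c ∈ C ] *_) ([≢]-refl c)) (*-zeroʳ [ c ∈ C ])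
      Σothers≡q : sum others-on-C ≡ q
      Σothers≡q = trans (sum-cong-≗ (λ p → *-comm [ p ∈ C ] [ p ≢ c ])) (circle-size-without c∈C)
      per-circle : ∀ L → [ v ∈ L ] * [ c ∈ L ] * tangent L + [ v ∈ L ] * [ c ∈ L ] * second-meets L
                         ≡ [ v ∈ L ] * [ c ∈ L ] * 1
      per-circle L = trans (sym (*-distribˡ-+ ([ v ∈ L ] * [ c ∈ L ]) (tangent L) (second-meets L)))
                           (on-pencil-≡ v c L tangent+second≡1)

  tangent≤1 : ∀ L → tangent L ≤ 1
  tangent≤1 L = χ≤1 (meet L C ≟ 1)

  tangent-pos⇒meet≡1 : ∀ {L} → 0 < tangent L → meet L C ≡ 1
  tangent-pos⇒meet≡1 {L} = χ-pos (meet L C ≟ 1)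

  tangent*meet≡tangent : ∀ L → tangent L * meet L C ≡ tangent L
  tangent*meet≡tangent L = lemma (meet L C)
    where
    lemma : ∀ m → χ (m ≟ 1) * m ≡ χ (m ≟ 1)
    lemma zero          = refl
    lemma (suc zero)    = refl
    lemma (suc (suc m)) = refl

  tangent-at : ∀ {c} → c ∈ circle C → Σ Circle λ L → v ∈ circle L × c ∈ circle L × meet L C ≡ 1
  tangent-at {c} c∈C =
    let (L , pos) = sum-pos⇒∃-pos (λ L → [ v ∈ L ] * [ c ∈ L ] * tangent L) (≤-reflexive (sym (tangents-at≡1 c∈C)))
        (v∈L , c∈L) = [∈]*[∈]-pos⇒∈ (*-pos⇒posˡ ([ v ∈ L ] * [ c ∈ L ]) _ pos)
    in L , v∈L , c∈L , tangent-pos⇒meet≡1 (*-pos⇒posʳ ([ v ∈ L ] * [ c ∈ L ]) _ pos)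

  tangent-at-unique : ∀ {c L L′} → c ∈ circle C →
    v ∈ circle L  → c ∈ circle L  → meet L C ≡ 1 →
    v ∈ circle L′ → c ∈ circle L′ → meet L′ C ≡ 1 → L ≡ L′
  tangent-at-unique {c} c∈C v∈L c∈L L-tan v∈L′ c∈L′ L′-tan =
    sum≡1⇒unique (λ L → [ v ∈ L ] * [ c ∈ L ] * tangent L) (tangents-at≡1 c∈C) _ _ (pos v∈L c∈L L-tan) (pos v∈L′ c∈L′ L′-tan)
    where
    pos : ∀ {L} → v ∈ circle L → c ∈ circle L → meet L C ≡ 1 → 0 < [ v ∈ L ] * [ c ∈ L ] * tangent L
    pos {L} v∈L c∈L L-tan rewrite ∈⇒[∈]≡1 v∈L | ∈⇒[∈]≡1 c∈L | L-tan = s≤s z≤n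

  tangents-through-v : sum (λ L → [ v ∈ L ] * tangent L) ≡ suc q
  tangents-through-v = begin
    sum (λ L → [ v ∈ L ] * tangent L)
      ≡⟨ sum-cong-≗ (λ L → cong ([ v ∈ L ] *_) (sym (tangent*meet≡tangent L))) ⟩
    sum (λ L → [ v ∈ L ] * (tangent L * meet L C))
      ≡⟨ sum-cong-≗ (λ L → trans (sym (*-assoc [ v ∈ L ] (tangent L) (meet L C)))
                                 (*-distribˡ-sum ([ v ∈ L ] * tangent L) (λ p → [ p ∈ L ] * [ p ∈ C ]))) ⟩
    sum (λ L → sum (λ p → [ v ∈ L ] * tangent L * ([ p ∈ L ] * [ p ∈ C ])))
      ≡⟨ ∑-comm (λ L p → [ v ∈ L ] * tangent L * ([ p ∈ L ] * [ p ∈ C ])) ⟩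
    sum (λ p → sum (λ L → [ v ∈ L ] * tangent L * ([ p ∈ L ] * [ p ∈ C ])))
      ≡⟨ sum-cong-≗ (λ p → trans (sum-cong-≗ (λ L → rearrange [ v ∈ L ] (tangent L) [ p ∈ L ] [ p ∈ C ]))
                                 (sym (*-distribˡ-sum [ p ∈ C ] (λ L → [ v ∈ L ] * [ p ∈ L ] * tangent L)))) ⟩
    sum (λ p → [ p ∈ C ] * tangents-through p)
      ≡⟨ sum-cong-≗ (λ p → trans (on-circle-≡ p C tangents-at≡1) (*-identityʳ [ p ∈ C ])) ⟩
    sum (λ p → [ p ∈ C ])
      ≡⟨ circle-size C ⟩
    suc q ∎
    where
    open ≡-Reasoning
    rearrange : ∀ a b c d → a * b * (c * d) ≡ d * (a * c * b)
    rearrange = solve-∀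

  secant : Circle → ℕ
  secant L = χ (meet L C ≟ 2)

  secants-through : Point → ℕ
  secants-through z = sum (λ L → [ v ∈ L ] * [ z ∈ L ] * secant L)

  tangents+2*secants : ∀ {z} → z ≢ v → z ∉ circle C → tangents-through z + 2 * secants-through z ≡ suc q
  tangents+2*secants {z} z≢v z∉C = begin
    tangents-through z + 2 * secants-through z
      ≡⟨ cong (tangents-through z +_) (*-distribˡ-sum 2 (λ L → [ v ∈ L ] * [ z ∈ L ] * secant L)) ⟩
    tangents-through z + sum (λ L → 2 * ([ v ∈ L ] * [ z ∈ L ] * secant L))
      ≡⟨ sym (∑-distrib-+ (λ L → [ v ∈ L ] * [ z ∈ L ] * tangent L) (λ L → 2 * ([ v ∈ L ] * [ z ∈ L ] * secant L))) ⟩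
    sum (λ L → [ v ∈ L ] * [ z ∈ L ] * tangent L + 2 * ([ v ∈ L ] * [ z ∈ L ] * secant L))
      ≡⟨ sum-cong-≗ per-circle ⟩
    sum (λ L → [ v ∈ L ] * [ z ∈ L ] * meet L C)
      ≡⟨ pencil-partition (λ e → z≢v (sym e)) (λ p → [ p ∈ C ]) (∉⇒[∈]≡0 v∉C) (∉⇒[∈]≡0 z∉C) ⟩
    sum (λ p → [ p ∈ C ])
      ≡⟨ circle-size C ⟩
    suc q ∎
    where
    open ≡-Reasoning
    factor : ∀ w a b → w * a + 2 * (w * b) ≡ w * (a + 2 * b)
    factor = solve-∀
    meet-by-kind : ∀ m → m ≤ 2 → χ (m ≟ 1) + 2 * χ (m ≟ 2) ≡ m
    meet-by-kind zero                _ = refl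
    meet-by-kind (suc zero)          _ = refl
    meet-by-kind (suc (suc zero))    _ = refl
    meet-by-kind (suc (suc (suc m))) (s≤s (s≤s ()))
    per-circle : ∀ L → [ v ∈ L ] * [ z ∈ L ] * tangent L + 2 * ([ v ∈ L ] * [ z ∈ L ] * secant L)
                       ≡ [ v ∈ L ] * [ z ∈ L ] * meet L C
    per-circle L = trans (factor ([ v ∈ L ] * [ z ∈ L ]) (tangent L) (secant L))
      (sym (on-pencil-≡ v z L (λ v∈L _ → sym (meet-by-kind (meet L C) (meet≤2-through-v v∈L)))))

  tangents-through-odd : 2 ∣ q → ∀ {z} → z ≢ v → z ∉ circle C → tangents-through z ≢ 0 × tangents-through z ≢ 2
  tangents-through-odd 2∣q {z} z≢v z∉C =
    t+2s≡odd⇒t≢0∧t≢2 {t = tangents-through z} {s = secants-through z} 2∣q (tangents+2*secants z≢v z∉C)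

  away : Point → ℕ
  away z = [ z ≢ v ] * [ z ∉ C ]

  away≤1 : ∀ z → away z ≤ 1
  away≤1 z = *-mono-≤ ([≢]≤1 z v) (m∸n≤m 1 [ z ∈ C ])

  away-pos⇒ : ∀ {z} → 0 < away z → z ≢ v × z ∉ circle C
  away-pos⇒ {z} pos = [≢]-pos z v (*-pos⇒posˡ [ z ≢ v ] _ pos) , not-on-C
    where
    not-on-C : z ∉ circle C
    not-on-C z∈C with () ← subst (λ m → 0 < 1 ∸ m) (∈⇒[∈]≡1 z∈C) (*-pos⇒posʳ [ z ≢ v ] [ z ∉ C ] pos)

  away-count : sum away + suc q ≡ q * q
  away-count = begin
    sum away + suc q
      ≡⟨ cong (sum away +_) (sym C-without-v) ⟩
    sum away + sum (λ z → [ z ≢ v ] * [ z ∈ C ])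
      ≡⟨ sym (∑-distrib-+ away (λ z → [ z ≢ v ] * [ z ∈ C ])) ⟩
    sum (λ z → away z + [ z ≢ v ] * [ z ∈ C ])
      ≡⟨ sym (sum-cong-≗ ≢v-split) ⟩
    sum (λ z → [ z ≢ v ] * 1)
      ≡⟨ point-count-without v ⟩
    q * q ∎
    where
    open ≡-Reasoning
    ≢v-split : ∀ z → [ z ≢ v ] * 1 ≡ away z + [ z ≢ v ] * [ z ∈ C ]
    ≢v-split z = trans (cong ([ z ≢ v ] *_) (sym ([∉]+[∈]≡1 z C))) (*-distribˡ-+ [ z ≢ v ] [ z ∉ C ] [ z ∈ C ])
    C-without-v : sum (λ z → [ z ≢ v ] * [ z ∈ C ]) ≡ suc q
    C-without-v = sym (trans (sym (circle-size C))
                             (trans (sum-extract v (λ z → [ z ∈ C ])) (cong (_+ sum (λ z → [ z ≢ v ] * [ z ∈ C ])) (∉⇒[∈]≡0 v∉C))))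

  away-on-circle : ∀ {L} → v ∈ circle L → sum (λ z → [ z ∈ L ] * away z) + meet L C ≡ q
  away-on-circle {L} v∈L = begin
    sum (λ z → [ z ∈ L ] * away z) + meet L C
      ≡⟨ cong (sum (λ z → [ z ∈ L ] * away z) +_) meet-without-v ⟩
    sum (λ z → [ z ∈ L ] * away z) + sum (λ z → [ z ≢ v ] * ([ z ∈ L ] * [ z ∈ C ]))
      ≡⟨ sym (∑-distrib-+ (λ z → [ z ∈ L ] * away z) (λ z → [ z ≢ v ] * ([ z ∈ L ] * [ z ∈ C ]))) ⟩
    sum (λ z → [ z ∈ L ] * away z + [ z ≢ v ] * ([ z ∈ L ] * [ z ∈ C ]))
      ≡⟨ sum-cong-≗ per-point ⟩
    sum (λ z → [ z ≢ v ] * [ z ∈ L ])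
      ≡⟨ circle-size-without v∈L ⟩
    q ∎
    where
    open ≡-Reasoning
    meet-without-v : meet L C ≡ sum (λ z → [ z ≢ v ] * ([ z ∈ L ] * [ z ∈ C ]))
    meet-without-v = trans (sum-extract v (λ z → [ z ∈ L ] * [ z ∈ C ]))
                           (cong (_+ sum (λ z → [ z ≢ v ] * ([ z ∈ L ] * [ z ∈ C ]))) (trans (cong ([ v ∈ L ] *_) (∉⇒[∈]≡0 v∉C)) (*-zeroʳ [ v ∈ L ])))
    distribute : ∀ n l o c → l * (n * o) + n * (l * c) ≡ n * l * (o + c)
    distribute = solve-∀
    per-point : ∀ z → [ z ∈ L ] * away z + [ z ≢ v ] * ([ z ∈ L ] * [ z ∈ C ]) ≡ [ z ≢ v ] * [ z ∈ L ]
    per-point z = trans (distribute [ z ≢ v ] [ z ∈ L ] [ z ∉ C ] [ z ∈ C ])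
                        (trans (cong ([ z ≢ v ] * [ z ∈ L ] *_) ([∉]+[∈]≡1 z C)) (*-identityʳ _))

  tangent-incidences : (w : Point → ℕ) →
    sum (λ z → w z * tangents-through z) ≡ sum (λ L → [ v ∈ L ] * tangent L * sum (λ z → [ z ∈ L ] * w z))
  tangent-incidences w = begin
    sum (λ z → w z * tangents-through z)
      ≡⟨ sum-cong-≗ (λ z → *-distribˡ-sum (w z) (λ L → [ v ∈ L ] * [ z ∈ L ] * tangent L)) ⟩
    sum (λ z → sum (λ L → w z * ([ v ∈ L ] * [ z ∈ L ] * tangent L)))
      ≡⟨ ∑-comm (λ z L → w z * ([ v ∈ L ] * [ z ∈ L ] * tangent L)) ⟩
    sum (λ L → sum (λ z → w z * ([ v ∈ L ] * [ z ∈ L ] * tangent L)))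
      ≡⟨ sum-cong-≗ (λ L → trans (sum-cong-≗ (λ z → rearrange (w z) [ v ∈ L ] [ z ∈ L ] (tangent L)))
                                 (sym (*-distribˡ-sum ([ v ∈ L ] * tangent L) (λ z → [ z ∈ L ] * w z)))) ⟩
    sum (λ L → [ v ∈ L ] * tangent L * sum (λ z → [ z ∈ L ] * w z)) ∎
    where
    open ≡-Reasoning
    rearrange : ∀ o a b c → o * (a * b * c) ≡ a * c * (b * o)
    rearrange = solve-∀

  on-tangent-through-v-≡ : ∀ L {x y} → (v ∈ circle L → meet L C ≡ 1 → x ≡ y) →
    [ v ∈ L ] * tangent L * x ≡ [ v ∈ L ] * tangent L * y
  on-tangent-through-v-≡ L h = guarded-≡ (*-mono-≤ ([∈]≤1 v L) (tangent≤1 L)) (λ e →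
    h ([∈]≡1⇒∈ (m*n≡1⇒m≡1 [ v ∈ L ] (tangent L) e)) (tangent-pos⇒meet≡1 (≤-reflexive (sym (m*n≡1⇒n≡1 [ v ∈ L ] (tangent L) e)))))

  on-tangent-through-v-≤ : ∀ L {x y} → (v ∈ circle L → meet L C ≡ 1 → x ≤ y) →
    [ v ∈ L ] * tangent L * x ≤ [ v ∈ L ] * tangent L * y
  on-tangent-through-v-≤ L h = guarded-≤ (*-mono-≤ ([∈]≤1 v L) (tangent≤1 L)) (λ e →
    h ([∈]≡1⇒∈ (m*n≡1⇒m≡1 [ v ∈ L ] (tangent L) e)) (tangent-pos⇒meet≡1 (≤-reflexive (sym (m*n≡1⇒n≡1 [ v ∈ L ] (tangent L) e)))))

  away-tangent-incidences : sum (λ z → away z * tangents-through z) ≡ suc q * suc k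
  away-tangent-incidences = begin
    sum (λ z → away z * tangents-through z)
      ≡⟨ tangent-incidences away ⟩
    sum (λ L → [ v ∈ L ] * tangent L * sum (λ z → [ z ∈ L ] * away z))
      ≡⟨ sum-cong-≗ (λ L → on-tangent-through-v-≡ L (away-on-tangent L)) ⟩
    sum (λ L → [ v ∈ L ] * tangent L * suc k)
      ≡⟨ sym (*-distribʳ-sum (suc k) (λ L → [ v ∈ L ] * tangent L)) ⟩
    sum (λ L → [ v ∈ L ] * tangent L) * suc k
      ≡⟨ cong (_* suc k) tangents-through-v ⟩
    suc q * suc k ∎
    where
    open ≡-Reasoning
    away-on-tangent : ∀ L → v ∈ circle L → meet L C ≡ 1 → sum (λ z → [ z ∈ L ] * away z) ≡ suc k
    away-on-tangent L v∈L L-tan = +-cancelʳ-≡ 1 _ _ (begin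
      sum (λ z → [ z ∈ L ] * away z) + 1        ≡⟨ cong (sum (λ z → [ z ∈ L ] * away z) +_) (sym L-tan) ⟩
      sum (λ z → [ z ∈ L ] * away z) + meet L C ≡⟨ away-on-circle v∈L ⟩
      q                                         ≡⟨ +-comm 1 (suc k) ⟩
      suc k + 1                                 ∎)

  point-on-many-tangents : Σ Point λ z → z ≢ v × z ∉ circle C × 2 ≤ tangents-through z
  point-on-many-tangents =
    let (z , az<az*Tz) = sum-<⇒∃-< away (λ z → away z * tangents-through z) Σaway<Σaway*T
        az>0 = *-pos⇒posˡ (away z) (tangents-through z) (≤-trans (s≤s z≤n) az<az*Tz)
        az≡1 = ≤-antisym (away≤1 z) az>0
        (z≢v , z∉C) = away-pos⇒ az>0
        1<Tz = subst (λ a → a < a * tangents-through z) az≡1 az<az*Tz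
    in z , z≢v , z∉C , subst (2 ≤_) (+-identityʳ (tangents-through z)) 1<Tz
    where
    square+q : ∀ k → (2 + k) * (2 + k) + (2 + k) ≡ (3 + k) * (1 + k) + (3 + k)
    square+q = solve-∀
    swap-last : ∀ a q → a + q + suc q ≡ a + suc q + q
    swap-last = solve-∀
    Σaway+q : sum away + q ≡ sum (λ z → away z * tangents-through z)
    Σaway+q = +-cancelʳ-≡ (suc q) _ _ (begin
      sum away + q + suc q  ≡⟨ swap-last (sum away) q ⟩
      sum away + suc q + q  ≡⟨ cong (_+ q) away-count ⟩
      q * q + q             ≡⟨ square+q k ⟩
      suc q * suc k + suc q ≡⟨ cong (_+ suc q) away-tangent-incidences ⟨
      sum (λ z → away z * tangents-through z) + suc q ∎)
      where open ≡-Reasoning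
    Σaway<Σaway*T : sum away < sum (λ z → away z * tangents-through z)
    Σaway<Σaway*T = ≤-trans (≤-reflexive (+-comm 1 (sum away)))
                            (≤-trans (+-monoʳ-≤ (sum away) (s≤s z≤n)) (≤-reflexive Σaway+q))

  -- The q − 2 points W of a secant ℓ through v off C ∪ {v} each lie on an odd number of the
  -- q + 1 tangents through v, while a tangent meets ℓ ∖ {v} at most once, and the two tangents
  -- at the points of ℓ ∩ C not at all.
  module OnSecant (2∣q : 2 ∣ q) {ℓ : Circle} (v∈ℓ : v ∈ circle ℓ) (ℓ-secant : meet ℓ C ≡ 2) where

    W : Point → ℕ
    W u = [ u ∈ ℓ ] * away u

    W≤[≢v]*meet : ∀ L u → [ u ∈ L ] * W u ≤ [ u ≢ v ] * ([ u ∈ L ] * [ u ∈ ℓ ])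
    W≤[≢v]*meet L u = ≤-trans (≤-reflexive (reorder [ u ∈ L ] [ u ∈ ℓ ] [ u ≢ v ] [ u ∉ C ]))
                              (≤-trans (*-monoʳ-≤ ([ u ≢ v ] * ([ u ∈ L ] * [ u ∈ ℓ ])) (m∸n≤m 1 [ u ∈ C ]))
                                       (≤-reflexive (*-identityʳ ([ u ≢ v ] * ([ u ∈ L ] * [ u ∈ ℓ ])))))
      where
      reorder : ∀ l m n o → l * (m * (n * o)) ≡ n * (l * m) * o
      reorder = solve-∀

    ΣW≡k : sum W ≡ k
    ΣW≡k = +-cancelʳ-≡ 2 _ _ (trans (cong (sum W +_) (sym ℓ-secant)) (trans (away-on-circle v∈ℓ) (+-comm 2 k)))

    tangent≢ℓ : ∀ {L} → meet L C ≡ 1 → L ≢ ℓ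
    tangent≢ℓ L-tan refl with () ← trans (sym L-tan) ℓ-secant

    W-on-tangent≤1 : ∀ {L} → v ∈ circle L → meet L C ≡ 1 → sum (λ u → [ u ∈ L ] * W u) ≤ 1
    W-on-tangent≤1 {L} v∈L L-tan =
      ≤-trans (sum-mono-≤ (W≤[≢v]*meet L)) (meet-without-≤1 (tangent≢ℓ L-tan) v∈L v∈ℓ)

    W-on-tangent-at≡0 : ∀ {c L} → c ∈ circle ℓ → c ∈ circle C → v ∈ circle L → c ∈ circle L → meet L C ≡ 1 →
      sum (λ u → [ u ∈ L ] * W u) ≡ 0
    W-on-tangent-at≡0 {c} {L} c∈ℓ c∈C v∈L c∈L L-tan = n≤0⇒n≡0 (≤-trans (sum-mono-≤ bound)
      (≤-reflexive (meet-without₂≡0 (tangent≢ℓ L-tan) (λ e → ∈C⇒≢v c∈C (sym e)) v∈L v∈ℓ c∈L c∈ℓ)))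
      where
      bound : ∀ u → [ u ∈ L ] * W u ≤ [ u ≢ c ] * ([ u ≢ v ] * ([ u ∈ L ] * [ u ∈ ℓ ]))
      bound u with u ≟ᶠ c
      ... | yes refl rewrite ∈⇒[∈]≡1 c∈C | *-zeroʳ [ u ≢ v ] | *-zeroʳ [ u ∈ ℓ ] | *-zeroʳ [ u ∈ L ] = z≤n
      ... | no  u≢c  rewrite [≢]-≢ u c u≢c = ≤-trans (W≤[≢v]*meet L u) (≤-reflexive (sym (+-identityʳ _)))

    W-tangent-incidences+2≤1+q : sum (λ u → W u * tangents-through u) + 2 ≤ suc q
    W-tangent-incidences+2≤1+q =
      through-common-points (two-in-support (λ p → [ p ∈ ℓ ] * [ p ∈ C ]) (λ p → [∈]*[∈]-common≤1 p ℓ C)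
                                            (≤-reflexive (sym ℓ-secant)))
      where
      g : Circle → ℕ
      g L = [ v ∈ L ] * tangent L
      h : Circle → ℕ
      h L = g L * sum (λ u → [ u ∈ L ] * W u)
      h≤g : ∀ L → h L ≤ g L
      h≤g L = ≤-trans (on-tangent-through-v-≤ L W-on-tangent≤1) (≤-reflexive (*-identityʳ (g L)))
      h<g : ∀ {c L} → c ∈ circle ℓ → c ∈ circle C → v ∈ circle L → c ∈ circle L → meet L C ≡ 1 → h L < g L
      h<g {c} {L} c∈ℓ c∈C v∈L c∈L L-tan = begin-strict
        h L     ≡⟨ cong (g L *_) (W-on-tangent-at≡0 c∈ℓ c∈C v∈L c∈L L-tan) ⟩
        g L * 0 ≡⟨ *-zeroʳ (g L) ⟩
        0       <⟨ s≤s z≤n ⟩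
        1       ≡⟨ cong₂ _*_ (∈⇒[∈]≡1 v∈L) (χ-yes (meet L C ≟ 1) L-tan) ⟨
        g L     ∎
        where open ≤-Reasoning
      through-tangents : ∀ {c₁ c₂} → c₁ ≢ c₂ → c₁ ∈ circle ℓ → c₁ ∈ circle C → c₂ ∈ circle ℓ → c₂ ∈ circle C →
        Σ Circle (λ L → v ∈ circle L × c₁ ∈ circle L × meet L C ≡ 1) →
        Σ Circle (λ L → v ∈ circle L × c₂ ∈ circle L × meet L C ≡ 1) →
        sum (λ u → W u * tangents-through u) + 2 ≤ suc q
      through-tangents c₁≢c₂ c₁∈ℓ c₁∈C c₂∈ℓ c₂∈C (L₁ , v∈L₁ , c₁∈L₁ , L₁-tan) (L₂ , v∈L₂ , c₂∈L₂ , L₂-tan) = begin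
        sum (λ u → W u * tangents-through u) + 2  ≡⟨ cong (_+ 2) (tangent-incidences W) ⟩
        sum h + 2                                 ≤⟨ sum-mono-≤-gap₂ h g L₁ L₂ h≤g L₁≢L₂
                                                       (h<g c₁∈ℓ c₁∈C v∈L₁ c₁∈L₁ L₁-tan) (h<g c₂∈ℓ c₂∈C v∈L₂ c₂∈L₂ L₂-tan) ⟩
        sum g                                     ≡⟨ tangents-through-v ⟩
        suc q                                     ∎
        where
        open ≤-Reasoning
        L₁≢L₂ : L₁ ≢ L₂
        L₁≢L₂ refl = c₁≢c₂ (meet≡1⇒common-unique L₁-tan c₁∈L₁ c₁∈C c₂∈L₂ c₂∈C)
      through-common-points : (Σ Point λ c₁ → Σ Point λ c₂ → c₁ ≢ c₂ ×
                                 0 < [ c₁ ∈ ℓ ] * [ c₁ ∈ C ] × 0 < [ c₂ ∈ ℓ ] * [ c₂ ∈ C ]) →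
        sum (λ u → W u * tangents-through u) + 2 ≤ suc q
      through-common-points (c₁ , c₂ , c₁≢c₂ , c₁-common , c₂-common) =
        let (c₁∈ℓ , c₁∈C) = common-pos⇒∈ {c₁} {ℓ} {C} c₁-common
            (c₂∈ℓ , c₂∈C) = common-pos⇒∈ {c₂} {ℓ} {C} c₂-common
        in through-tangents c₁≢c₂ c₁∈ℓ c₁∈C c₂∈ℓ c₂∈C (tangent-at c₁∈C) (tangent-at c₂∈C)

    W+2≤W-tangent-incidences : ∀ {z} → z ∈ circle ℓ → z ≢ v → z ∉ circle C → 2 ≤ tangents-through z →
      sum W + 2 ≤ sum (λ u → W u * tangents-through u)
    W+2≤W-tangent-incidences {z} z∈ℓ z≢v z∉C 2≤T = sum-mono-≤-gap W (λ u → W u * tangents-through u) z W≤WT Wz+2≤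
      where
      W≤WT : ∀ u → W u ≤ W u * tangents-through u
      W≤WT u = ≤-trans (≤-reflexive (sym (*-identityʳ (W u))))
        (guarded-≤ (*-mono-≤ ([∈]≤1 u ℓ) (away≤1 u)) (λ Wu≡1 →
          let (u≢v , u∉C) = away-pos⇒ {u} (≤-reflexive (sym (m*n≡1⇒n≡1 [ u ∈ ℓ ] (away u) Wu≡1)))
          in n≢0⇒n>0 (proj₁ (tangents-through-odd 2∣q {u} u≢v u∉C))))
      Wz≡1 : W z ≡ 1
      Wz≡1 rewrite ∈⇒[∈]≡1 z∈ℓ | ∉⇒[∈]≡0 z∉C | [≢]-≢ z v z≢v = refl
      3≤T : 3 ≤ tangents-through z
      3≤T = ≤∧≢⇒< 2≤T (λ e → proj₂ (tangents-through-odd 2∣q z≢v z∉C) (sym e))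
      Wz+2≤ : W z + 2 ≤ W z * tangents-through z
      Wz+2≤ rewrite Wz≡1 | +-identityʳ (tangents-through z) = 3≤T

  rich-point-not-on-secant : 2 ∣ q → ∀ {z ℓ} → z ≢ v → z ∉ circle C → 2 ≤ tangents-through z →
    v ∈ circle ℓ → z ∈ circle ℓ → meet ℓ C ≢ 2
  rich-point-not-on-secant 2∣q {z} z≢v z∉C 2≤T v∈ℓ z∈ℓ ℓ-secant = <-irrefl refl (begin-strict
    k + 4                                       ≡⟨ +-assoc k 2 2 ⟨
    k + 2 + 2                                   ≡⟨ cong (λ w → w + 2 + 2) (sym ΣW≡k) ⟩
    sum W + 2 + 2                               ≤⟨ +-monoˡ-≤ 2 (W+2≤W-tangent-incidences z∈ℓ z≢v z∉C 2≤T) ⟩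
    sum (λ u → W u * tangents-through u) + 2    ≤⟨ W-tangent-incidences+2≤1+q ⟩
    suc q                                       ≡⟨ +-comm 3 k ⟩
    k + 3                                       <⟨ +-monoʳ-< k (s≤s (s≤s (s≤s (s≤s z≤n)))) ⟩
    k + 4                                       ∎)
    where
    open OnSecant 2∣q v∈ℓ ℓ-secant
    open ≤-Reasoning

  record Nucleus : Set where
    field
      point                 : Point
      point≢v               : point ≢ v
      through-point⇒tangent : ∀ {L} → v ∈ circle L → point ∈ circle L → meet L C ≡ 1
      tangent⇒through-point : ∀ {L} → v ∈ circle L → meet L C ≡ 1 → point ∈ circle L

  -- Abstract for the same reason as `sum-<⇒∃-<`.
  abstract
    nucleus : 2 ∣ q → Nucleus
    nucleus 2∣q = from-rich-point point-on-many-tangents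
      where
      from-rich-point : (Σ Point λ z → z ≢ v × z ∉ circle C × 2 ≤ tangents-through z) → Nucleus
      from-rich-point (z , z≢v , z∉C , 2≤T) = record
        { point                 = z
        ; point≢v               = z≢v
        ; through-point⇒tangent = through-z⇒tangent
        ; tangent⇒through-point = tangent⇒through-z
        }
        where
        v≢z : v ≢ z
        v≢z e = z≢v (sym e)
        w : Circle → ℕ
        w L = [ v ∈ L ] * [ z ∈ L ]
        weighted-meet≤w : ∀ L → w L * meet L C ≤ w L
        weighted-meet≤w L = ≤-trans
          (on-pencil-≤ v z L (λ v∈L z∈L → ≤-pred (≤∧≢⇒< (meet≤2-through-v v∈L) (rich-point-not-on-secant 2∣q z≢v z∉C 2≤T v∈L z∈L))))
          (≤-reflexive (*-identityʳ (w L)))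
        Σweighted-meet≡Σw : sum (λ L → w L * meet L C) ≡ sum w
        Σweighted-meet≡Σw = trans (pencil-partition v≢z (λ p → [ p ∈ C ]) (∉⇒[∈]≡0 v∉C) (∉⇒[∈]≡0 z∉C))
                                  (trans (circle-size C) (sym (pencil-size v≢z)))
        through-z⇒tangent : ∀ {L} → v ∈ circle L → z ∈ circle L → meet L C ≡ 1
        through-z⇒tangent {L} v∈L z∈L =
          let w≡1 : w L ≡ 1
              w≡1 = cong₂ _*_ (∈⇒[∈]≡1 v∈L) (∈⇒[∈]≡1 z∈L)
          in trans (sym (+-identityʳ (meet L C)))
               (subst (λ x → x * meet L C ≡ x) w≡1 (sum-mono-≤-tight _ w weighted-meet≤w Σweighted-meet≡Σw L))
        tangent⇒through-z : ∀ {L} → v ∈ circle L → meet L C ≡ 1 → z ∈ circle L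
        tangent⇒through-z {L} v∈L L-tan =
          let (c , c-common) = sum-pos⇒∃-pos (λ p → [ p ∈ L ] * [ p ∈ C ]) (≤-reflexive (sym L-tan))
              (c∈L , c∈C) = common-pos⇒∈ {c} {L} {C} c-common
              z≢c : z ≢ c
              z≢c z≡c = z∉C (subst (λ p → p ∈ circle C) (sym z≡c) c∈C)
              (L′ , v∈L′ , z∈L′ , c∈L′) = threeExist v z c v≢z (λ e → ∈C⇒≢v c∈C (sym e)) z≢c
          in subst (λ X → z ∈ circle X)
               (tangent-at-unique c∈C v∈L′ c∈L′ (through-z⇒tangent v∈L′ z∈L′) v∈L c∈L L-tan) z∈L′

module PencilTangents {k : ℕ} (I : InversivePlane (suc (suc k))) (2∣q : 2 ∣ suc (suc k)) (x : InversivePlane.Point I) where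

  open Incidence I
  open TangentsThrough I using (Nucleus; nucleus; tangent-at-unique)
  open Nucleus

  -- Abstract for the same reason as `sum-<⇒∃-<`.
  abstract
    TangentToPencil? : ∀ y C → Dec (TangentToPencil x y C)
    TangentToPencil? y C = all? (λ d → (x ∈? circle d) →-dec ((y ∈? circle d) →-dec (∣ circle C ∩ circle d ∣ ≟ 1)))

  tangent-to : Point → Circle → ℕ
  tangent-to y C = χ (TangentToPencil? y C)

  pencil-meet≡1 : ∀ {y C d} → TangentToPencil x y C → x ∈ circle d → y ∈ circle d → meet C d ≡ 1
  pencil-meet≡1 tp x∈d y∈d = Tangent⇒meet≡1 (tp _ x∈d y∈d)

  pencil-tangent-avoids : ∀ {y C} → y ≢ x → TangentToPencil x y C → x ∉ circle C × y ∉ circle C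
  pencil-tangent-avoids {y} {C} y≢x tp =
    let (c , c∈C , c≢x , c≢y) = ∃-on-circle-avoiding₂ C (λ e → y≢x (sym e))
        (D , x∈D , y∈D , c∈D) = threeExist x y c (λ e → y≢x (sym e)) (λ e → c≢x (sym e)) (λ e → c≢y (sym e))
        meet≡1 = pencil-meet≡1 tp x∈D y∈D
    in (λ x∈C → c≢x (meet≡1⇒common-unique meet≡1 c∈C c∈D x∈C x∈D)) ,
       (λ y∈C → c≢y (meet≡1⇒common-unique meet≡1 c∈C c∈D y∈C y∈D))

  tangent-to-nucleus-pencil : ∀ {C} (x∉C : x ∉ circle C) → TangentToPencil x (point (nucleus x C x∉C 2∣q)) C
  tangent-to-nucleus-pencil {C} x∉C d x∈d N∈d =
    meet≡1⇒Tangent (trans (meet-sym C d) (through-point⇒tangent (nucleus x C x∉C 2∣q) x∈d N∈d))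

  pencil-is-nucleus : ∀ {y C} (x∉C : x ∉ circle C) → y ≢ x → TangentToPencil x y C → y ≡ point (nucleus x C x∉C 2∣q)
  pencil-is-nucleus {y} {C} x∉C y≢x tp = decidable-stable (y ≟ᶠ N) y≢N-impossible
    where
    nu : Nucleus x C x∉C
    nu = nucleus x C x∉C 2∣q
    N : Point
    N = point nu
    x≢y : x ≢ y
    x≢y e = y≢x (sym e)
    pencil-through-N : ∀ L → [ x ∈ L ] * [ y ∈ L ] ≡ [ x ∈ L ] * [ y ∈ L ] * [ N ∈ L ]
    pencil-through-N L = trans (sym (*-identityʳ ([ x ∈ L ] * [ y ∈ L ])))
      (on-pencil-≡ x y L (λ x∈L y∈L → sym (∈⇒[∈]≡1 (tangent⇒through-point nu x∈L
        (trans (meet-sym L C) (pencil-meet≡1 tp x∈L y∈L))))))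
    pencil-size≡1 : y ≢ N → suc q ≡ 1
    pencil-size≡1 y≢N = begin
      suc q                                         ≡⟨ pencil-size x≢y ⟨
      sum (λ L → [ x ∈ L ] * [ y ∈ L ])             ≡⟨ sum-cong-≗ pencil-through-N ⟩
      sum (λ L → [ x ∈ L ] * [ y ∈ L ] * [ N ∈ L ]) ≡⟨ circles-through-three≡1 x≢y (λ e → point≢v nu (sym e)) y≢N ⟩
      1                                             ∎
      where open ≡-Reasoning
    y≢N-impossible : ¬ y ≢ N
    y≢N-impossible y≢N with () ← pencil-size≡1 y≢N

  pencils-tangent-to : ∀ C → sum (λ y → [ y ≢ x ] * tangent-to y C) + [ x ∈ C ] ≡ 1
  pencils-tangent-to C = by-cases (x ∈? circle C)
    where
    f : Point → ℕ
    f y = [ y ≢ x ] * tangent-to y C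
    through-x : x ∈ circle C → ∀ y → f y ≡ 0
    through-x x∈C y with y ≟ᶠ x
    ... | yes refl = cong (_* tangent-to y C) ([≢]-refl y)
    ... | no  y≢x  = trans (cong ([ y ≢ x ] *_) (χ-no (TangentToPencil? y C) (λ tp → proj₁ (pencil-tangent-avoids y≢x tp) x∈C)))
                           (*-zeroʳ [ y ≢ x ])
    avoiding-x : (x∉C : x ∉ circle C) → sum f ≡ 1
    avoiding-x x∉C = ≤-antisym (sum≤1 f f≤1 unique) (≤-trans (≤-reflexive (sym fN≡1)) (term≤sum N f))
      where
      nu : Nucleus x C x∉C
      nu = nucleus x C x∉C 2∣q
      N : Point
      N = point nu
      f≤1 : ZeroOne f
      f≤1 y = *-mono-≤ ([≢]≤1 y x) (χ≤1 (TangentToPencil? y C))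
      fN≡1 : f N ≡ 1
      fN≡1 = cong₂ _*_ ([≢]-≢ N x (point≢v nu)) (χ-yes (TangentToPencil? N C) (tangent-to-nucleus-pencil x∉C))
      f-pos⇒N : ∀ {y} → 0 < f y → y ≡ N
      f-pos⇒N {y} pos = pencil-is-nucleus x∉C ([≢]-pos y x (*-pos⇒posˡ [ y ≢ x ] (tangent-to y C) pos))
                          (χ-pos (TangentToPencil? y C) (*-pos⇒posʳ [ y ≢ x ] (tangent-to y C) pos))
      unique : ∀ y y′ → 0 < f y → 0 < f y′ → y ≡ y′
      unique y y′ fy>0 fy′>0 = trans (f-pos⇒N fy>0) (sym (f-pos⇒N fy′>0))
    by-cases : Dec (x ∈ circle C) → sum f + [ x ∈ C ] ≡ 1
    by-cases (yes x∈C) = cong₂ _+_ (sum-zero (through-x x∈C)) (∈⇒[∈]≡1 x∈C)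
    by-cases (no  x∉C) = trans (cong₂ _+_ (avoiding-x x∉C) (∉⇒[∈]≡0 x∉C)) refl

  -- Both circles touch the circle Dₚ of the pencil through p at p, and both pass through the
  -- nucleus of p with respect to a circle D of the pencil missing p.
  pencil-tangents-disjoint : ∀ {y p C C′} → y ≢ x → TangentToPencil x y C → TangentToPencil x y C′ →
    p ∈ circle C → p ∈ circle C′ → C ≡ C′
  pencil-tangents-disjoint {y} {p} {C} {C′} y≢x tp tp′ p∈C p∈C′ =
    let (Dₚ , x∈Dₚ , y∈Dₚ , p∈Dₚ) = threeExist x y p x≢y x≢p y≢p
        (z , z∉Dₚ) = ∃-off-circle Dₚ
        x≢z : x ≢ z
        x≢z x≡z = z∉Dₚ (subst (λ u → u ∈ circle Dₚ) x≡z x∈Dₚ)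
        y≢z : y ≢ z
        y≢z y≡z = z∉Dₚ (subst (λ u → u ∈ circle Dₚ) y≡z y∈Dₚ)
        (D , x∈D , y∈D , z∈D) = threeExist x y z x≢y x≢z y≢z
        p∉D : p ∉ circle D
        p∉D p∈D = z∉Dₚ (subst (λ E → z ∈ circle E) (threeUnique x y p x≢y x≢p y≢p D Dₚ x∈D y∈D p∈D x∈Dₚ y∈Dₚ p∈Dₚ) z∈D)
        nu = nucleus p D p∉D 2∣q
        N∈C  = tangent⇒through-point nu p∈C  (pencil-meet≡1 tp  x∈D y∈D)
        N∈C′ = tangent⇒through-point nu p∈C′ (pencil-meet≡1 tp′ x∈D y∈D)
        N∉Dₚ : point nu ∉ circle Dₚ
        N∉Dₚ N∈Dₚ = point≢v nu (sym (meet≡1⇒common-unique (pencil-meet≡1 tp x∈Dₚ y∈Dₚ) p∈C p∈Dₚ N∈C N∈Dₚ))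
    in tangent-at-unique (point nu) Dₚ N∉Dₚ p∈Dₚ N∈C p∈C (pencil-meet≡1 tp x∈Dₚ y∈Dₚ) N∈C′ p∈C′ (pencil-meet≡1 tp′ x∈Dₚ y∈Dₚ)
    where
    x≢y : x ≢ y
    x≢y e = y≢x (sym e)
    x≢p : x ≢ p
    x≢p refl = proj₁ (pencil-tangent-avoids y≢x tp) p∈C
    y≢p : y ≢ p
    y≢p refl = proj₂ (pencil-tangent-avoids y≢x tp) p∈C

  incidences : Point → Point → ℕ
  incidences y p = sum (λ C → tangent-to y C * [ p ∈ C ])

  off-x-y : Point → Point → ℕ
  off-x-y y p = [ p ≢ y ] * ([ p ≢ x ] * 1)

  tangent-to*[∈]≡0 : ∀ {y p} C → (TangentToPencil x y C → p ∉ circle C) → tangent-to y C * [ p ∈ C ] ≡ 0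
  tangent-to*[∈]≡0 {y} {p} C avoids =
    trans (guarded-≡ (χ≤1 (TangentToPencil? y C)) (λ t≡1 → ∉⇒[∈]≡0 (avoids (χ-pos (TangentToPencil? y C) (≤-reflexive (sym t≡1))))))
          (*-zeroʳ (tangent-to y C))

  incidences≤off-x-y : ∀ {y} → y ≢ x → ∀ p → incidences y p ≤ off-x-y y p
  incidences≤off-x-y {y} y≢x p with p ≟ᶠ x | p ≟ᶠ y
  ... | yes refl | _        = ≤-trans (≤-reflexive (sum-zero (λ C → tangent-to*[∈]≡0 C (λ tp → proj₁ (pencil-tangent-avoids y≢x tp))))) z≤n
  ... | no  _    | yes refl = ≤-trans (≤-reflexive (sum-zero (λ C → tangent-to*[∈]≡0 C (λ tp → proj₂ (pencil-tangent-avoids y≢x tp))))) z≤n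
  ... | no  p≢x  | no  p≢y  rewrite [≢]-≢ p y p≢y | [≢]-≢ p x p≢x =
    sum≤1 (λ C → tangent-to y C * [ p ∈ C ]) (λ C → *-mono-≤ (χ≤1 (TangentToPencil? y C)) ([∈]≤1 p C)) unique
    where
    unique : ∀ C C′ → 0 < tangent-to y C * [ p ∈ C ] → 0 < tangent-to y C′ * [ p ∈ C′ ] → C ≡ C′
    unique C C′ pos pos′ = pencil-tangents-disjoint {p = p} y≢x
      (χ-pos (TangentToPencil? y C)  (*-pos⇒posˡ (tangent-to y C) _ pos))
      (χ-pos (TangentToPencil? y C′) (*-pos⇒posˡ (tangent-to y C′) _ pos′))
      ([∈]-pos⇒∈ {p} {C} (*-pos⇒posʳ (tangent-to y C) _ pos)) ([∈]-pos⇒∈ {p} {C′} (*-pos⇒posʳ (tangent-to y C′) _ pos′))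

  Σoff-x-y : ∀ {y} → y ≢ x → sum (off-x-y y) ≡ suc k * suc q
  Σoff-x-y {y} y≢x = +-cancelˡ-≡ 2 _ _ (begin
    2 + sum (off-x-y y)     ≡⟨ sum-extract₂ x y (λ _ → 1) (λ e → y≢x (sym e)) ⟨
    sum (λ (_ : Point) → 1) ≡⟨ point-count ⟩
    q * q + 1               ≡⟨ square+1 k ⟩
    2 + suc k * suc q       ∎)
    where
    open ≡-Reasoning
    square+1 : ∀ k → (2 + k) * (2 + k) + 1 ≡ 2 + (1 + k) * (3 + k)
    square+1 = solve-∀

  number-tangent-to : Point → ℕ
  number-tangent-to y = sum (tangent-to y)

  Σincidences : ∀ y → sum (incidences y) ≡ number-tangent-to y * suc q
  Σincidences y = begin
    sum (λ p → sum (λ C → tangent-to y C * [ p ∈ C ]))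
      ≡⟨ ∑-comm (λ p C → tangent-to y C * [ p ∈ C ]) ⟩
    sum (λ C → sum (λ p → tangent-to y C * [ p ∈ C ]))
      ≡⟨ sum-cong-≗ (λ C → trans (cong (tangent-to y C *_) (sym (circle-size C))) (*-distribˡ-sum (tangent-to y C) (λ p → [ p ∈ C ]))) ⟨
    sum (λ C → tangent-to y C * suc q)
      ≡⟨ *-distribʳ-sum (suc q) (tangent-to y) ⟨
    number-tangent-to y * suc q ∎
    where open ≡-Reasoning

  all-incidences : sum (λ y → [ y ≢ x ] * sum (incidences y)) ≡ sum (λ y → [ y ≢ x ] * (suc k * suc q))
  all-incidences = begin
    sum (λ y → [ y ≢ x ] * sum (incidences y))
      ≡⟨ sum-cong-≗ (λ y → trans (cong ([ y ≢ x ] *_) (trans (Σincidences y) (*-distribʳ-sum (suc q) (tangent-to y))))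
                                 (*-distribˡ-sum [ y ≢ x ] (λ C → tangent-to y C * suc q))) ⟩
    sum (λ y → sum (λ C → [ y ≢ x ] * (tangent-to y C * suc q)))
      ≡⟨ ∑-comm (λ y C → [ y ≢ x ] * (tangent-to y C * suc q)) ⟩
    sum (λ C → sum (λ y → [ y ≢ x ] * (tangent-to y C * suc q)))
      ≡⟨ sum-cong-≗ (λ C → trans (sum-cong-≗ (λ y → sym (*-assoc [ y ≢ x ] (tangent-to y C) (suc q))))
                                 (sym (*-distribʳ-sum (suc q) (λ y → [ y ≢ x ] * tangent-to y C)))) ⟩
    sum (λ C → sum (λ y → [ y ≢ x ] * tangent-to y C) * suc q)
      ≡⟨ sum-cong-≗ (λ C → cong (_* suc q) (pencils-tangent-to-avoiding C)) ⟩
    sum (λ C → [ x ∉ C ] * suc q)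
      ≡⟨ sum-cong-≗ (λ C → trans (cong ([ x ∉ C ] *_) (sym (circle-size C))) (*-distribˡ-sum [ x ∉ C ] (λ p → [ p ∈ C ]))) ⟩
    sum (λ C → sum (λ p → [ x ∉ C ] * [ p ∈ C ]))
      ≡⟨ ∑-comm (λ C p → [ x ∉ C ] * [ p ∈ C ]) ⟩
    sum (λ p → sum (λ C → [ x ∉ C ] * [ p ∈ C ]))
      ≡⟨ sum-cong-≗ (λ p → circles-through-avoiding p x) ⟩
    sum (λ y → [ y ≢ x ] * (suc k * suc q)) ∎
    where
    open ≡-Reasoning
    pencils-tangent-to-avoiding : ∀ C → sum (λ y → [ y ≢ x ] * tangent-to y C) ≡ [ x ∉ C ]
    pencils-tangent-to-avoiding C = trans (sym (m+n∸n≡m _ [ x ∈ C ])) (cong (_∸ [ x ∈ C ]) (pencils-tangent-to C))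

  Σincidences≡ : ∀ {y} → y ≢ x → sum (incidences y) ≡ suc k * suc q
  Σincidences≡ {y} y≢x = begin
    sum (incidences y)             ≡⟨ *-identityˡ (sum (incidences y)) ⟨
    1 * sum (incidences y)         ≡⟨ cong (_* sum (incidences y)) ([≢]-≢ y x y≢x) ⟨
    [ y ≢ x ] * sum (incidences y) ≡⟨ sum-mono-≤-tight _ _ weighted≤ all-incidences y ⟩
    [ y ≢ x ] * (suc k * suc q)    ≡⟨ cong (_* (suc k * suc q)) ([≢]-≢ y x y≢x) ⟩
    1 * (suc k * suc q)            ≡⟨ *-identityˡ (suc k * suc q) ⟩
    suc k * suc q                  ∎
    where
    open ≡-Reasoning
    weighted≤ : ∀ y → [ y ≢ x ] * sum (incidences y) ≤ [ y ≢ x ] * (suc k * suc q)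
    weighted≤ y with y ≟ᶠ x
    ... | yes refl rewrite [≢]-refl y = z≤n
    ... | no  y≢x  = *-monoʳ-≤ [ y ≢ x ] (≤-trans (sum-mono-≤ (incidences≤off-x-y y≢x)) (≤-reflexive (Σoff-x-y y≢x)))

  number-tangent-to≡q-1 : ∀ {y} → y ≢ x → number-tangent-to y ≡ suc k
  number-tangent-to≡q-1 {y} y≢x = *-cancelʳ-≡ _ _ (suc q) (trans (sym (Σincidences y)) (Σincidences≡ y≢x))

  pencil-tangent-through : ∀ {y p} → y ≢ x → p ≢ x → p ≢ y → Σ Circle λ C → TangentToPencil x y C × p ∈ circle C
  pencil-tangent-through {y} {p} y≢x p≢x p≢y =
    let (C , pos) = sum-pos⇒∃-pos (λ C → tangent-to y C * [ p ∈ C ]) (≤-reflexive (sym incidences≡1))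
    in C , χ-pos (TangentToPencil? y C) (*-pos⇒posˡ (tangent-to y C) _ pos) , [∈]-pos⇒∈ (*-pos⇒posʳ (tangent-to y C) _ pos)
    where
    incidences≡1 : incidences y p ≡ 1
    incidences≡1 = trans (sum-mono-≤-tight (incidences y) (off-x-y y) (incidences≤off-x-y y≢x)
                                           (trans (Σincidences≡ y≢x) (sym (Σoff-x-y y≢x))) p)
                         (cong₂ (λ a b → a * (b * 1)) ([≢]-≢ p y p≢y) ([≢]-≢ p x p≢x))

lemma3p4 : (q : ℕ) → 2 ∣ q → (I : InversivePlane q) →
    let open InversivePlane I in
    (x y : Point) → x ≢ y →
    Σ (Fin (q ∸ 1) → Circle) λ f →
      Injective _≡_ _≡_ f
      × (∀ c → TangentToPencil x y c ⇔ (∃ λ i → f i ≡ c))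
      × (∀ p → ((p ≢ x) × (p ≢ y)) ⇔ (∃ λ i → p ∈ circle (f i)))
      × (∀ p i j → p ∈ circle (f i) → p ∈ circle (f j) → i ≡ j)
lemma3p4 zero          _   _ zero zero x≢y = ⊥-elim (x≢y refl)
lemma3p4 (suc zero)    2∣1 _ _    _    _   with () ← ∣1⇒≡1 2∣1
lemma3p4 (suc (suc k)) 2∣q I x    y    x≢y = f , f-injective , tangent⇔ , covered⇔ , disjoint
  where
  open Incidence I
  open PencilTangents I 2∣q x
  y≢x : y ≢ x
  y≢x e = x≢y (sym e)
  enum : Σ (Fin (suc k) → Circle) λ f → Injective _≡_ _≡_ f × (∀ c → TangentToPencil x y c ⇔ (∃ λ i → f i ≡ c))
  enum = enumeration (TangentToPencil? y) (number-tangent-to≡q-1 y≢x)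
  f : Fin (suc k) → Circle
  f = proj₁ enum
  f-injective : Injective _≡_ _≡_ f
  f-injective = proj₁ (proj₂ enum)
  tangent⇔ : ∀ c → TangentToPencil x y c ⇔ (∃ λ i → f i ≡ c)
  tangent⇔ = proj₂ (proj₂ enum)
  f-tangent : ∀ i → TangentToPencil x y (f i)
  f-tangent i = Equivalence.from (tangent⇔ (f i)) (i , refl)
  covered⇔ : ∀ p → ((p ≢ x) × (p ≢ y)) ⇔ (∃ λ i → p ∈ circle (f i))
  covered⇔ p = mk⇔
    (λ (p≢x , p≢y) → let (C , tp , p∈C) = pencil-tangent-through y≢x p≢x p≢y
                         (i , fi≡C) = Equivalence.to (tangent⇔ C) tp
                     in i , subst (λ D → p ∈ circle D) (sym fi≡C) p∈C)
    (λ (i , p∈fi) → let (x∉fi , y∉fi) = pencil-tangent-avoids y≢x (f-tangent i)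
                    in (λ { refl → x∉fi p∈fi }) , (λ { refl → y∉fi p∈fi }))
  disjoint : ∀ p i j → p ∈ circle (f i) → p ∈ circle (f j) → i ≡ j
  disjoint p i j p∈fi p∈fj = f-injective (pencil-tangents-disjoint y≢x (f-tangent i) (f-tangent j) p∈fi p∈fj)
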